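{- Let $F=1+\sum_{i=1}^ta_iX^i\in\mathbb{F}_2[X]$, let $F=g_1^{e_1}\cdots g_r^{e_r}$ ($e_j\geq1$) be its factorization into irreducible factors, $d_j=\deg(g_j)$, and let $f=\gamma_0+\sum_{i=1}^ta_i\gamma_{2i}$ (viewed on $\mathbb{F}_2^n$ for every $n\ge 1$). Then $\xi(f)\subseteq\{2\ell: \ell\mid 2^{d_j}-1 \text{ for some } 1\leq j\leq r\}$; i.e. there is a set $\xi(f)$ contained in this set such that for every $n\geq1$, $f$ is not a permutation of $\mathbb{F}_2^n$ if and only if $n$ is a multiple of some element of $\xi(f)$.
   Context: For $n\geq1$ let $\mathbbm{1}=(1,\dots,1)\in\mathbb{F}_2^n$, let $\odot$ denote component-wise multiplication in $\mathbb{F}_2^n$, and let $S(x_1,\dots,x_n)=(x_2,\dots,x_n,x_1)$. Define $\gamma_0=\mathrm{id}$ and, for $k\geq1$, $\gamma_{2k}(x)=S^{2k}(x)\odot(\mathbbm{1}+S^{2k-1}(x))\odot(\mathbbm{1}+S^{2k-3}(x))\odot\cdots\odot(\mathbbm{1}+S(x))$ on $\mathbb{F}_2^n$; sums are pointwise. For such $f$, $\xi(f)$ denotes a set of positive integers such that $f$ is not a permutation of $\mathbb{F}_2^n$ iff $n$ is a multiple of some element of $\xi(f)$. -}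

module Defs where

open import Data.Bool using (Bool; true; false; not; _∧_; _xor_; if_then_else_)
open import Data.Nat using (ℕ; zero; suc; _+_; _*_; _∸_; _^_; _≥_)
open import Data.Nat.Divisibility using (_∣_)
open import Data.List using (List; []; _∷_; length)
open import Data.Vec using (Vec; []; _∷_; _∷ʳ_; map; zipWith; replicate)
open import Data.Fin using (Fin)
open import Data.Product using (Σ; ∃; _×_)
open import Data.Sum using (_⊎_)
open import Relation.Binary.PropositionalEquality using (_≡_)
open import Function.Definitions using (Bijective)

-- Vectors in F₂ⁿ (Bool = F₂, true = 1)

S : ∀ {n} → Vec Bool n → Vec Bool n
S []       = []
S (x ∷ xs) = xs ∷ʳ x

Sⁿ : ∀ {n} → ℕ → Vec Bool n → Vec Bool n
Sⁿ zero    x = x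
Sⁿ (suc k) x = S (Sⁿ k x)

_⊙_ : ∀ {n} → Vec Bool n → Vec Bool n → Vec Bool n
_⊙_ = zipWith _∧_

_⊕_ : ∀ {n} → Vec Bool n → Vec Bool n → Vec Bool n
_⊕_ = zipWith _xor_

𝟙 : ∀ {n} → Vec Bool n
𝟙 = replicate _ true

𝟘 : ∀ {n} → Vec Bool n
𝟘 = replicate _ false

compl : ∀ {n} → Vec Bool n → Vec Bool n
compl y = 𝟙 ⊕ y

prodOdd : ∀ {n} → ℕ → Vec Bool n → Vec Bool n
prodOdd zero    x = 𝟙
prodOdd (suc i) x = compl (Sⁿ (2 * i + 1) x) ⊙ prodOdd i x

-- γ k = γ_{2k}
γ : ∀ {n} → ℕ → Vec Bool n → Vec Bool n
γ zero    x = x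
γ (suc k) x = Sⁿ (2 * suc k) x ⊙ prodOdd (suc k) x

-- Σ_{i} a_i γ_{2i}, where the list holds a_i, a_{i+1}, … starting at index i
sumγ : ∀ {n} → List Bool → ℕ → Vec Bool n → Vec Bool n
sumγ []       i x = 𝟘
sumγ (b ∷ bs) i x = (if b then γ i x else 𝟘) ⊕ sumγ bs (suc i) x

-- f = γ₀ + Σ_{i=1}^t a_i γ_{2i}, with a = (a₁,…,a_t)
fMap : List Bool → ∀ {n} → Vec Bool n → Vec Bool n
fMap a x = γ 0 x ⊕ sumγ a 1 x

IsPermutation : ∀ {n} → (Vec Bool n → Vec Bool n) → Set
IsPermutation f = Bijective _≡_ _≡_ f

-- Polynomials over F₂ as coefficient lists (lowest degree first),
-- considered up to trailing zeros.

Poly : Set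
Poly = List Bool

norm : Poly → Poly
norm []       = []
norm (b ∷ p) with norm p
... | []    = if b then true ∷ [] else []
... | q ∷ qs = b ∷ q ∷ qs

_≈ₚ_ : Poly → Poly → Set
p ≈ₚ q = norm p ≡ norm q

_+ₚ_ : Poly → Poly → Poly
[]      +ₚ q       = q
(a ∷ p) +ₚ []      = a ∷ p
(a ∷ p) +ₚ (b ∷ q) = (a xor b) ∷ (p +ₚ q)

_*ₚ_ : Poly → Poly → Poly
[]      *ₚ q = []
(b ∷ p) *ₚ q = (if b then q else []) +ₚ (false ∷ (p *ₚ q))

oneₚ : Poly
oneₚ = true ∷ []

_^ₚ_ : Poly → ℕ → Poly
p ^ₚ zero  = oneₚ
p ^ₚ suc e = p *ₚ (p ^ₚ e)

-- degree (of the zero polynomial: 0, never used)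
deg : Poly → ℕ
deg p = length (norm p) ∸ 1

Irreducible : Poly → Set
Irreducible g = deg g ≥ 1 × (∀ a b → (a *ₚ b) ≈ₚ g → deg a ≡ 0 ⊎ deg b ≡ 0)

prodPow : (r : ℕ) → (Fin r → Poly) → (Fin r → ℕ) → Poly
prodPow zero    g e = oneₚ
prodPow (suc r) g e = (g Fin.zero ^ₚ e Fin.zero) *ₚ prodPow r (λ j → g (Fin.suc j)) (λ j → e (Fin.suc j))

polyF : List Bool → Poly
polyF a = true ∷ a

-- Read x ∈ F₂ⁿ as an n-periodic sequence s. Then f = f_F for F = 1 + Σ aᵢ Xⁱ, where
-- f_C(s) = c₀ s + T_s (f_{C′}(s)) and T_s v = (1 + σ s) · σ² v, and these maps compose like
-- polynomials: f_A ∘ f_{1+XB} = f_{A(1+XB)}. Composing with a power-series inverse of F modulo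
-- X^K leaves s + T_s^K(…), and T_s^K vanishes when n is odd, and when n = 2K and s has 1s at
-- both parities; so f is injective on those s. A sequence supported on one parity class is an
-- interleaving of a K-periodic w with 0, on which f acts as the linear map F(σ). Hence for
-- n = 2K, f fails to be a permutation exactly when F(σ) kills a nonzero K-periodic w.
-- Such a w yields a nonzero K-periodic sequence killed by an irreducible factor g of F, of
-- degree d say. In F₂[X]/(g), which has no zero divisors by Euclid's algorithm, Lagrange's
-- argument (multiplying all nonzero residues) gives X^(2^d - 1) = 1, so that sequence is
-- also (2^d - 1)-periodic, hence gcd(K, 2^d - 1)-periodic.

module Submission where

open import Algebra.Bundles using (CommutativeMonoid)
open import Data.Bool using (Bool; true; false; not; _∧_; _xor_; if_then_else_)
import Data.Bool.Properties as Bool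
open import Data.Bool.Properties
  using (∧-assoc; ∧-comm; ∧-identityʳ; ∧-zeroʳ; ∧-distribˡ-xor; ∧-distribʳ-xor;
         xor-assoc; xor-comm; xor-identityʳ; xor-same)
open import Data.Bool.Solver using (module xor-∧-Solver)
open import Data.Empty using (⊥; ⊥-elim)
open import Data.Fin using (Fin; zero; suc; toℕ; fromℕ; inject₁; combine; remQuot; punchIn; punchOut)
import Data.Fin.Properties as Fin
open import Data.Fin.Properties
  using (toℕ-injective; toℕ-inject₁; toℕ-fromℕ; toℕ<n; toℕ-fromℕ<; any?; all?;
         remQuot-combine; combine-remQuot; punchInᵢ≢i; punchOut-injective; injective⇒≤)
open import Data.Fin.Permutation using (Permutation; permutation)
open import Data.List using (List; []; _∷_; _++_; [_]; length; replicate)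
open import Data.List.Properties using (length-++)
open import Data.Nat using (ℕ; zero; suc; _+_; _*_; _∸_; _^_; _≤_; _<_; _≥_; z≤n; s≤s; _≡ᵇ_)
open import Data.Nat.DivMod using (_mod_; _%_; _/_; m≡m%n+[m/n]*n; m<n⇒m%n≡m; [m+kn]%n≡m%n; [m+n]%n≡m%n; n%n≡0)
open import Data.Nat.Divisibility using (_∣_; divides; ∣-refl; ∣-trans; *-monoʳ-∣; 0∣⇒≡0)
open import Data.Nat.GCD using (gcd; gcd-GCD; gcd[m,n]∣m; gcd[m,n]∣n; module Bézout)
open import Data.Nat.Properties using (+-suc; +-comm; +-assoc; *-distribˡ-+; ≤-refl; ≤-trans; n≤1+n; n≮n)
open import Data.Nat.Tactic.RingSolver using (solve-∀)
open import Data.Product using (Σ; ∃; ∃₂; _×_; _,_; proj₁; proj₂)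
open import Data.Sum using (_⊎_; inj₁; inj₂)
open import Data.Vec using (Vec; []; _∷_; _∷ʳ_; lookup; zipWith; tabulate; toList; fromList)
import Data.Vec as Vec
open import Data.Vec.Properties
  using (lookup-zipWith; lookup-replicate; lookup∘tabulate; tabulate∘lookup; tabulate-cong;
         ≡-dec; length-toList; toList∘fromList)
open import Function using (_∘_)
open import Function.Bundles using (_⇔_; mk⇔; Equivalence)
open import Function.Consequences.Propositional using (strictlySurjective⇒surjective)
open import Function.Definitions using (Injective; StrictlySurjective)
open import Relation.Binary.PropositionalEquality hiding ([_])
open import Relation.Nullary using (¬_; Dec; yes; no; contradiction; ¬?; _×-dec_)
import Relation.Nullary.Decidable as Dec

open import Defs

open ≡-Reasoning
open xor-∧-Solver using (solve; _:=_; _:+_; _:*_; con)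

xor-interchange : ∀ a b c d → (a xor b) xor (c xor d) ≡ (a xor c) xor (b xor d)
xor-interchange = solve 4 (λ a b c d → (a :+ b) :+ (c :+ d) := (a :+ c) :+ (b :+ d)) refl

∧-swap : ∀ a b c → a ∧ (b ∧ c) ≡ b ∧ (a ∧ c)
∧-swap = solve 3 (λ a b c → a :* (b :* c) := b :* (a :* c)) refl

xor-cancelˡ : ∀ a b → (a xor b) xor a ≡ b
xor-cancelˡ false b = xor-identityʳ b
xor-cancelˡ true  false = refl
xor-cancelˡ true  true  = refl

xor≡false⇒≡ : ∀ {a b} → a xor b ≡ false → a ≡ b
xor≡false⇒≡ {false} {false} _ = refl
xor≡false⇒≡ {true}  {true}  _ = refl

-- Periodic sequences

Seq : Set
Seq = ℕ → Bool

Periodic : ℕ → Seq → Set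
Periodic n s = ∀ i → s (n + i) ≡ s i

σ : Seq → Seq
σ s i = s (suc i)

0ₛ : Seq
0ₛ _ = false

_⊕ₛ_ : Seq → Seq → Seq
(u ⊕ₛ v) i = u i xor v i

periodic-* : ∀ {n s} q → Periodic n s → Periodic (q * n) s
periodic-* zero    p i = refl
periodic-* {n} {s} (suc q) p i = begin
  s ((n + q * n) + i)  ≡⟨ cong s (+-assoc n (q * n) i) ⟩
  s (n + (q * n + i))  ≡⟨ p (q * n + i) ⟩
  s (q * n + i)        ≡⟨ periodic-* q p i ⟩
  s i                  ∎

periodic-mod : ∀ {m s} → Periodic (suc m) s → ∀ i → s i ≡ s (i % suc m)
periodic-mod {m} {s} p i = begin
  s i                              ≡⟨ cong s (m≡m%n+[m/n]*n i (suc m)) ⟩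
  s (i % suc m + i / suc m * suc m) ≡⟨ cong s (+-comm (i % suc m) _) ⟩
  s (i / suc m * suc m + i % suc m) ≡⟨ periodic-* (i / suc m) p (i % suc m) ⟩
  s (i % suc m)                    ∎

periodic-≗0 : ∀ {m s} → Periodic (suc m) s → (∀ (j : Fin (suc m)) → s (toℕ j) ≡ false) → s ≗ 0ₛ
periodic-≗0 {m} {s} p zeros i = trans (periodic-mod p i) (trans (cong s (sym (toℕ-fromℕ< _))) (zeros (i mod suc m)))

periodic-≗0⊎nonzero : ∀ {m s} → Periodic (suc m) s → s ≗ 0ₛ ⊎ ∃ λ i → s i ≡ true
periodic-≗0⊎nonzero {m} {s} p with any? (λ (j : Fin (suc m)) → s (toℕ j) Bool.≟ true)
... | yes (j , e) = inj₂ (toℕ j , e)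
... | no  none    = inj₁ (periodic-≗0 p λ j → Bool.¬-not λ e → none (j , e))

data EvenOdd : ℕ → Set where
  even : ∀ a → EvenOdd (2 * a)
  odd  : ∀ a → EvenOdd (suc (2 * a))

evenOdd : ∀ i → EvenOdd i
evenOdd zero    = even 0
evenOdd (suc i) with evenOdd i
... | even a = odd a
... | odd  a = subst EvenOdd (cong suc (+-suc a (a + 0))) (even (suc a))

toSeq : ∀ {m} → Vec Bool (suc m) → Seq
toSeq {m} x i = lookup x (i mod suc m)

fromSeq : ∀ {m} → Seq → Vec Bool (suc m)
fromSeq s = tabulate (s ∘ toℕ)

private
  toℕ-mod : ∀ {m} i → toℕ (i mod suc m) ≡ i % suc m
  toℕ-mod i = toℕ-fromℕ< _

  mod-cong : ∀ {m} i j → i % suc m ≡ j % suc m → i mod suc m ≡ j mod suc m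
  mod-cong {m} i j e = toℕ-injective (trans (toℕ-mod i) (trans e (sym (toℕ-mod j))))

  toℕ-mod-id : ∀ {m} (j : Fin (suc m)) → toℕ j mod suc m ≡ j
  toℕ-mod-id j = toℕ-injective (trans (toℕ-mod (toℕ j)) (m<n⇒m%n≡m (toℕ<n j)))

  data LastOrInject₁ {m} : Fin (suc m) → Set where
    last    : LastOrInject₁ (fromℕ m)
    inject : ∀ j → LastOrInject₁ (inject₁ j)

  lastOrInject₁ : ∀ {m} (j : Fin (suc m)) → LastOrInject₁ j
  lastOrInject₁ {zero}  zero    = last
  lastOrInject₁ {suc m} zero    = inject zero
  lastOrInject₁ {suc m} (suc j) with lastOrInject₁ j
  ... | last     = last
  ... | inject j = inject (suc j)

  lookup-∷ʳ-last : ∀ {m} (xs : Vec Bool m) a → lookup (xs ∷ʳ a) (fromℕ m) ≡ a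
  lookup-∷ʳ-last []       a = refl
  lookup-∷ʳ-last (x ∷ xs) a = lookup-∷ʳ-last xs a

  lookup-∷ʳ-inject₁ : ∀ {m} (xs : Vec Bool m) a j → lookup (xs ∷ʳ a) (inject₁ j) ≡ lookup xs j
  lookup-∷ʳ-inject₁ (x ∷ xs) a zero    = refl
  lookup-∷ʳ-inject₁ (x ∷ xs) a (suc j) = lookup-∷ʳ-inject₁ xs a j

  lookup-S : ∀ {m} (x : Vec Bool (suc m)) j → lookup (S x) j ≡ lookup x (suc (toℕ j) mod suc m)
  lookup-S {m} (a ∷ xs) j with lastOrInject₁ j
  ... | last = trans (lookup-∷ʳ-last xs a) (cong (lookup (a ∷ xs)) (sym wraps))
    where
    wraps : suc (toℕ (fromℕ m)) mod suc m ≡ zero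
    wraps = mod-cong (suc (toℕ (fromℕ m))) 0 (trans (cong (λ k → suc k % suc m) (toℕ-fromℕ m)) (n%n≡0 (suc m)))
  ... | inject j = trans (lookup-∷ʳ-inject₁ xs a j) (cong (lookup (a ∷ xs)) (sym stays))
    where
    stays : suc (toℕ (inject₁ j)) mod suc m ≡ suc j
    stays = trans (mod-cong (suc (toℕ (inject₁ j))) (toℕ (suc j)) (cong (λ k → suc k % suc m) (toℕ-inject₁ j)))
                  (toℕ-mod-id (suc j))

toSeq-S : ∀ {m} (x : Vec Bool (suc m)) → toSeq (S x) ≗ σ (toSeq x)
toSeq-S {m} x i = trans (lookup-S x (i mod suc m)) (cong (lookup x) (mod-cong (suc (toℕ (i mod suc m))) (suc i) (begin
  suc (toℕ (i mod suc m)) % suc m                  ≡⟨ cong (λ k → suc k % suc m) (toℕ-mod i) ⟩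
  suc (i % suc m) % suc m                          ≡⟨ [m+kn]%n≡m%n (suc (i % suc m)) (i / suc m) (suc m) ⟨
  (suc (i % suc m) + i / suc m * suc m) % suc m    ≡⟨ cong (λ k → suc k % suc m) (m≡m%n+[m/n]*n i (suc m)) ⟨
  suc i % suc m                                    ∎)))

toSeq-Sⁿ : ∀ {m} (x : Vec Bool (suc m)) k i → toSeq (Sⁿ k x) i ≡ toSeq x (k + i)
toSeq-Sⁿ x zero    i = refl
toSeq-Sⁿ x (suc k) i = begin
  toSeq (S (Sⁿ k x)) i   ≡⟨ toSeq-S (Sⁿ k x) i ⟩
  toSeq (Sⁿ k x) (suc i) ≡⟨ toSeq-Sⁿ x k (suc i) ⟩
  toSeq x (k + suc i)    ≡⟨ cong (toSeq x) (+-suc k i) ⟩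
  toSeq x (suc k + i)    ∎

toSeq-periodic : ∀ {m} (x : Vec Bool (suc m)) → Periodic (suc m) (toSeq x)
toSeq-periodic {m} x i = cong (lookup x) (mod-cong (suc m + i) i (trans (cong (_% suc m) (+-comm (suc m) i)) ([m+n]%n≡m%n i (suc m))))

toSeq-zipWith : ∀ {m} f (x y : Vec Bool (suc m)) i → toSeq (zipWith f x y) i ≡ f (toSeq x i) (toSeq y i)
toSeq-zipWith f x y i = lookup-zipWith f (i mod _) x y

toSeq-replicate : ∀ {m} b i → toSeq (Vec.replicate (suc m) b) i ≡ b
toSeq-replicate b i = lookup-replicate (i mod _) b

toSeq-injective : ∀ {m} {x y : Vec Bool (suc m)} → toSeq x ≗ toSeq y → x ≡ y
toSeq-injective {x = x} {y} e = begin
  x                         ≡⟨ tabulate∘lookup x ⟨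
  tabulate (lookup x)       ≡⟨ tabulate-cong agree ⟩
  tabulate (lookup y)       ≡⟨ tabulate∘lookup y ⟩
  y                         ∎
  where
  agree : lookup x ≗ lookup y
  agree j = begin
    lookup x j                ≡⟨ cong (lookup x) (toℕ-mod-id j) ⟨
    toSeq x (toℕ j)           ≡⟨ e (toℕ j) ⟩
    toSeq y (toℕ j)           ≡⟨ cong (lookup y) (toℕ-mod-id j) ⟩
    lookup y j                ∎

toSeq-fromSeq : ∀ {m s} → Periodic (suc m) s → toSeq {m} (fromSeq s) ≗ s
toSeq-fromSeq {m} {s} p i = begin
  lookup (tabulate (s ∘ toℕ)) (i mod suc m) ≡⟨ lookup∘tabulate (s ∘ toℕ) (i mod suc m) ⟩
  s (toℕ (i mod suc m))                     ≡⟨ cong s (toℕ-mod i) ⟩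
  s (i % suc m)                             ≡⟨ periodic-mod p i ⟨
  s i                                       ∎

-- On sequences γ_{2k} is Tⁿ k s s (toSeq-γ), and fSeq C is Σ c_k γ_{2k} in Horner form.
T : Seq → Seq → Seq
T s v i = not (s (suc i)) ∧ v (suc (suc i))

Tⁿ : ℕ → Seq → Seq → Seq
Tⁿ zero    s v = v
Tⁿ (suc k) s v = T s (Tⁿ k s v)

prodOddₛ : ℕ → Seq → Seq
prodOddₛ zero    s i = true
prodOddₛ (suc j) s i = not (s (2 * j + 1 + i)) ∧ prodOddₛ j s i

fSeq : Poly → Seq → Seq
fSeq []       s i = false
fSeq (c ∷ cs) s i = (c ∧ s i) xor T s (fSeq cs s) i

T-cong : ∀ s {u v} → u ≗ v → T s u ≗ T s v
T-cong s e i = cong (not (s (suc i)) ∧_) (e (suc (suc i)))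

Tⁿ-cong : ∀ k s {u v} → u ≗ v → Tⁿ k s u ≗ Tⁿ k s v
Tⁿ-cong zero    s e = e
Tⁿ-cong (suc k) s e = T-cong s (Tⁿ-cong k s e)

fSeq-cong : ∀ C {s s′} → s ≗ s′ → fSeq C s ≗ fSeq C s′
fSeq-cong []      e i = refl
fSeq-cong (c ∷ C) e i =
  cong₂ _xor_ (cong (c ∧_) (e i)) (cong₂ (λ a b → not a ∧ b) (e (suc i)) (fSeq-cong C e (suc (suc i))))

Tⁿ-⊕ : ∀ k s u v → Tⁿ k s (u ⊕ₛ v) ≗ Tⁿ k s u ⊕ₛ Tⁿ k s v
Tⁿ-⊕ zero    s u v i = refl
Tⁿ-⊕ (suc k) s u v i = trans (T-cong s (Tⁿ-⊕ k s u v) i) (∧-distribˡ-xor (not (s (suc i))) _ _)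

Tⁿ-0 : ∀ k s → Tⁿ k s 0ₛ ≗ 0ₛ
Tⁿ-0 zero    s i = refl
Tⁿ-0 (suc k) s i = trans (T-cong s (Tⁿ-0 k s) i) (∧-zeroʳ _)

Tⁿ-scale : ∀ k s b v i → Tⁿ k s (λ j → b ∧ v j) i ≡ b ∧ Tⁿ k s v i
Tⁿ-scale zero    s b v i = refl
Tⁿ-scale (suc k) s b v i = trans (T-cong s (Tⁿ-scale k s b v) i) (∧-swap (not (s (suc i))) b _)

Tⁿ-sucʳ : ∀ k s v → Tⁿ (suc k) s v ≗ Tⁿ k s (T s v)
Tⁿ-sucʳ zero    s v i = refl
Tⁿ-sucʳ (suc k) s v   = T-cong s (Tⁿ-sucʳ k s v)

prodOddₛ-sucˡ : ∀ k s i → prodOddₛ (suc k) s i ≡ not (s (suc i)) ∧ prodOddₛ k s (2 + i)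
prodOddₛ-sucˡ zero    s i = refl
prodOddₛ-sucˡ (suc k) s i = begin
  not (s (2 * suc k + 1 + i)) ∧ prodOddₛ (suc k) s i
    ≡⟨ cong₂ (λ j p → not (s j) ∧ p) (index k i) (prodOddₛ-sucˡ k s i) ⟩
  not (s (2 * k + 1 + (2 + i))) ∧ (not (s (suc i)) ∧ prodOddₛ k s (2 + i))
    ≡⟨ ∧-swap (not (s (2 * k + 1 + (2 + i)))) (not (s (suc i))) _ ⟩
  not (s (suc i)) ∧ prodOddₛ (suc k) s (2 + i)
    ∎
  where
  index : ∀ k i → 2 * (1 + k) + 1 + i ≡ 2 * k + 1 + (2 + i)
  index = solve-∀

Tⁿ-closed : ∀ k s v i → Tⁿ k s v i ≡ prodOddₛ k s i ∧ v (2 * k + i)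
Tⁿ-closed zero    s v i = refl
Tⁿ-closed (suc k) s v i = begin
  not (s (suc i)) ∧ Tⁿ k s v (2 + i)
    ≡⟨ cong (not (s (suc i)) ∧_) (Tⁿ-closed k s v (2 + i)) ⟩
  not (s (suc i)) ∧ (prodOddₛ k s (2 + i) ∧ v (2 * k + (2 + i)))
    ≡⟨ ∧-assoc (not (s (suc i))) (prodOddₛ k s (2 + i)) _ ⟨
  (not (s (suc i)) ∧ prodOddₛ k s (2 + i)) ∧ v (2 * k + (2 + i))
    ≡⟨ cong₂ _∧_ (prodOddₛ-sucˡ k s i) (cong v (index k i)) ⟨
  prodOddₛ (suc k) s i ∧ v (2 * suc k + i)
    ∎
  where
  index : ∀ k i → 2 * (1 + k) + i ≡ 2 * k + (2 + i)
  index = solve-∀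

module _ {m : ℕ} (x : Vec Bool (suc m)) where

  toSeq-prodOdd : ∀ k → toSeq (prodOdd k x) ≗ prodOddₛ k (toSeq x)
  toSeq-prodOdd zero    i = toSeq-replicate true i
  toSeq-prodOdd (suc k) i = begin
    toSeq (compl (Sⁿ (2 * k + 1) x) ⊙ prodOdd k x) i
      ≡⟨ toSeq-zipWith _∧_ (compl (Sⁿ (2 * k + 1) x)) (prodOdd k x) i ⟩
    toSeq (𝟙 ⊕ Sⁿ (2 * k + 1) x) i ∧ toSeq (prodOdd k x) i
      ≡⟨ cong₂ _∧_ complement (toSeq-prodOdd k i) ⟩
    not (toSeq x (2 * k + 1 + i)) ∧ prodOddₛ k (toSeq x) i
      ∎
    where
    complement : toSeq (𝟙 ⊕ Sⁿ (2 * k + 1) x) i ≡ not (toSeq x (2 * k + 1 + i))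
    complement = trans (toSeq-zipWith _xor_ 𝟙 (Sⁿ (2 * k + 1) x) i)
                       (cong₂ _xor_ (toSeq-replicate true i) (toSeq-Sⁿ x (2 * k + 1) i))

  toSeq-γ : ∀ k → toSeq (γ k x) ≗ Tⁿ k (toSeq x) (toSeq x)
  toSeq-γ zero    i = refl
  toSeq-γ (suc k) i = begin
    toSeq (Sⁿ (2 * suc k) x ⊙ prodOdd (suc k) x) i
      ≡⟨ toSeq-zipWith _∧_ (Sⁿ (2 * suc k) x) (prodOdd (suc k) x) i ⟩
    toSeq (Sⁿ (2 * suc k) x) i ∧ toSeq (prodOdd (suc k) x) i
      ≡⟨ cong₂ _∧_ (toSeq-Sⁿ x (2 * suc k) i) (toSeq-prodOdd (suc k) i) ⟩
    toSeq x (2 * suc k + i) ∧ prodOddₛ (suc k) (toSeq x) i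
      ≡⟨ ∧-comm (toSeq x (2 * suc k + i)) _ ⟩
    prodOddₛ (suc k) (toSeq x) i ∧ toSeq x (2 * suc k + i)
      ≡⟨ Tⁿ-closed (suc k) (toSeq x) (toSeq x) i ⟨
    Tⁿ (suc k) (toSeq x) (toSeq x) i
      ∎

  toSeq-sumγ : ∀ bs k → toSeq (sumγ bs k x) ≗ Tⁿ k (toSeq x) (fSeq bs (toSeq x))
  toSeq-sumγ []       k i = trans (toSeq-replicate false i) (sym (Tⁿ-0 k s i))
    where
      s : Seq
      s = toSeq x
  toSeq-sumγ (b ∷ bs) k i = begin
    toSeq ((if b then γ k x else 𝟘) ⊕ sumγ bs (suc k) x) i
      ≡⟨ toSeq-zipWith _xor_ (if b then γ k x else 𝟘) (sumγ bs (suc k) x) i ⟩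
    toSeq (if b then γ k x else 𝟘) i xor toSeq (sumγ bs (suc k) x) i
      ≡⟨ cong₂ _xor_ (scaled b) (toSeq-sumγ bs (suc k) i) ⟩
    Tⁿ k s (λ j → b ∧ s j) i xor Tⁿ (suc k) s (fSeq bs s) i
      ≡⟨ cong (Tⁿ k s (λ j → b ∧ s j) i xor_) (Tⁿ-sucʳ k s (fSeq bs s) i) ⟩
    Tⁿ k s (λ j → b ∧ s j) i xor Tⁿ k s (T s (fSeq bs s)) i
      ≡⟨ Tⁿ-⊕ k s (λ j → b ∧ s j) (T s (fSeq bs s)) i ⟨
    Tⁿ k s (fSeq (b ∷ bs) s) i
      ∎
    where
    s : Seq
    s = toSeq x
    scaled : ∀ b → toSeq (if b then γ k x else 𝟘) i ≡ Tⁿ k s (λ j → b ∧ s j) i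
    scaled true  = toSeq-γ k i
    scaled false = trans (toSeq-replicate false i) (sym (Tⁿ-0 k s i))

  toSeq-fMap : ∀ a → toSeq (fMap a x) ≗ fSeq (true ∷ a) (toSeq x)
  toSeq-fMap a i = trans (toSeq-zipWith _xor_ x (sumγ a 1 x) i) (cong (toSeq x i xor_) (toSeq-sumγ a 1 i))

fSeq-+ : ∀ p q s → fSeq (p +ₚ q) s ≗ fSeq p s ⊕ₛ fSeq q s
fSeq-+ []      q       s i = refl
fSeq-+ (a ∷ p) []      s i = sym (xor-identityʳ _)
fSeq-+ (a ∷ p) (b ∷ q) s i = begin
  ((a xor b) ∧ s i) xor T s (fSeq (p +ₚ q) s) i
    ≡⟨ cong₂ _xor_ (∧-distribʳ-xor (s i) a b) (Tⁿ-cong 1 s (fSeq-+ p q s) i) ⟩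
  ((a ∧ s i) xor (b ∧ s i)) xor T s (fSeq p s ⊕ₛ fSeq q s) i
    ≡⟨ cong (((a ∧ s i) xor (b ∧ s i)) xor_) (Tⁿ-⊕ 1 s (fSeq p s) (fSeq q s) i) ⟩
  ((a ∧ s i) xor (b ∧ s i)) xor (T s (fSeq p s) i xor T s (fSeq q s) i)
    ≡⟨ xor-interchange (a ∧ s i) (b ∧ s i) _ _ ⟩
  fSeq (a ∷ p) s i xor fSeq (b ∷ q) s i
    ∎

fSeq-scale : ∀ b q s i → fSeq (if b then q else []) s i ≡ b ∧ fSeq q s i
fSeq-scale true  q s i = refl
fSeq-scale false q s i = refl

fSeq-0 : ∀ C → fSeq C 0ₛ ≗ 0ₛ
fSeq-0 []      i = refl
fSeq-0 (c ∷ C) i = cong₂ _xor_ (∧-zeroʳ c) (fSeq-0 C (2 + i))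

fSeq-1 : ∀ s → fSeq [ true ] s ≗ s
fSeq-1 s i = trans (cong (s i xor_) (∧-zeroʳ _)) (xor-identityʳ (s i))

shiftₚ : ℕ → Poly → Poly
shiftₚ m p = replicate m false ++ p

shiftₚ-*ₚ : ∀ m p q → shiftₚ m p *ₚ q ≡ shiftₚ m (p *ₚ q)
shiftₚ-*ₚ zero    p q = refl
shiftₚ-*ₚ (suc m) p q = cong (false ∷_) (shiftₚ-*ₚ m p q)

fSeq-shiftₚ : ∀ m H s → fSeq (shiftₚ m H) s ≗ Tⁿ m s (fSeq H s)
fSeq-shiftₚ zero    H s = λ _ → refl
fSeq-shiftₚ (suc m) H s = T-cong s (fSeq-shiftₚ m H s)

Tⁿ-fSeq-∷ : ∀ k s h H i → Tⁿ k s (fSeq (h ∷ H) s) i ≡ (h ∧ Tⁿ k s s i) xor Tⁿ (suc k) s (fSeq H s) i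
Tⁿ-fSeq-∷ k s h H i = begin
  Tⁿ k s (fSeq (h ∷ H) s) i
    ≡⟨ Tⁿ-⊕ k s (λ j → h ∧ s j) (T s (fSeq H s)) i ⟩
  Tⁿ k s (λ j → h ∧ s j) i xor Tⁿ k s (T s (fSeq H s)) i
    ≡⟨ cong₂ _xor_ (Tⁿ-scale k s h s i) (sym (Tⁿ-sucʳ k s (fSeq H s) i)) ⟩
  (h ∧ Tⁿ k s s i) xor Tⁿ (suc k) s (fSeq H s) i
    ∎

private
  gap-step : ∀ s₁ s₂ s₃ c d u v → not s₃ ∧ (u ∧ v) ≡ false →
             not s₁ ∧ (((c ∧ s₁) xor (not s₂ ∧ u)) ∧ ((d ∧ s₂) xor (not s₃ ∧ v))) ≡ false
  gap-step true  s₂    s₃ c     d     u v h = refl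
  gap-step false true  s₃ false d     u v h = refl
  gap-step false true  s₃ true  d     u v h = refl
  gap-step false false s₃ false false u v h = trans (∧-swap u (not s₃) v) h
  gap-step false false s₃ false true  u v h = trans (∧-swap u (not s₃) v) h
  gap-step false false s₃ true  false u v h = trans (∧-swap u (not s₃) v) h
  gap-step false false s₃ true  true  u v h = trans (∧-swap u (not s₃) v) h

  gate-transfer : ∀ a b u z → not b ∧ (z ∧ u) ≡ false → not (a xor (not b ∧ u)) ∧ z ≡ not a ∧ z
  gate-transfer false true  u     z     _ = refl
  gate-transfer true  true  u     z     _ = refl
  gate-transfer a     false false z     _ = cong (λ b → not b ∧ z) (xor-identityʳ a)
  gate-transfer a     false true  false _ = trans (∧-zeroʳ _) (sym (∧-zeroʳ _))

fSeq-gap : ∀ C D s i → not (s (suc i)) ∧ (fSeq C s (suc i) ∧ fSeq D s (2 + i)) ≡ false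
fSeq-gap []      D       s i = ∧-zeroʳ _
fSeq-gap (c ∷ C) []      s i = trans (cong (not (s (suc i)) ∧_) (∧-zeroʳ _)) (∧-zeroʳ _)
fSeq-gap (c ∷ C) (d ∷ D) s i =
  gap-step (s (1 + i)) (s (2 + i)) (s (3 + i)) c d _ _ (fSeq-gap C D s (2 + i))

-- The gates of y = fSeq (true ∷ B) s agree with those of s wherever they matter, by fSeq-gap.
fSeq-∘ : ∀ A B s → fSeq A (fSeq (true ∷ B) s) ≗ fSeq (A *ₚ (true ∷ B)) s
fSeq-∘ []      B s i = refl
fSeq-∘ (a ∷ A) B s i = begin
  (a ∧ y i) xor (not (y (suc i)) ∧ fSeq A y (2 + i))
    ≡⟨ cong (λ z → (a ∧ y i) xor (not (y (suc i)) ∧ z)) (fSeq-∘ A B s (2 + i)) ⟩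
  (a ∧ y i) xor (not (y (suc i)) ∧ fSeq AF s (2 + i))
    ≡⟨ cong ((a ∧ y i) xor_) (gate-transfer (s (1 + i)) (s (2 + i)) (fSeq B s (3 + i)) _ (fSeq-gap AF B s (suc i))) ⟩
  (a ∧ y i) xor T s (fSeq AF s) i
    ≡⟨ cong (_xor T s (fSeq AF s) i) (fSeq-scale a (true ∷ B) s i) ⟨
  fSeq (if a then true ∷ B else []) s i xor fSeq (false ∷ AF) s i
    ≡⟨ fSeq-+ (if a then true ∷ B else []) (false ∷ AF) s i ⟨
  fSeq ((a ∷ A) *ₚ (true ∷ B)) s i
    ∎
  where
  y : Seq
  y = fSeq (true ∷ B) s
  AF : Poly
  AF = A *ₚ (true ∷ B)

private
  cancel-middle : ∀ s a b c → (s xor (a xor b)) xor (a xor c) ≡ s xor (b xor c)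
  cancel-middle = solve 4 (λ s a b c → (s :+ (a :+ b)) :+ (a :+ c) := s :+ (b :+ c)) refl

-- G is a power-series inverse of F = 1 + X·a modulo X^(k+1), read through fSeq.
fSeq-inverse-mod : ∀ a k → ∃₂ λ G H → ∀ s → fSeq G (fSeq (true ∷ a) s) ≗ s ⊕ₛ Tⁿ (suc k) s (fSeq H s)
fSeq-inverse-mod a zero    = [ true ] , a , λ s → fSeq-1 (fSeq (true ∷ a) s)
fSeq-inverse-mod a (suc k) with fSeq-inverse-mod a k
... | G , []        , e = G , [] , λ s i → trans (e s i) (cong (s i xor_) (trans (Tⁿ-0 (suc k) s i) (sym (Tⁿ-0 (suc (suc k)) s i))))
... | G , false ∷ H , e = G , H , λ s i → trans (e s i) (cong (s i xor_) (Tⁿ-fSeq-∷ (suc k) s false H i))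
... | G , true ∷ H  , e = G +ₚ X^N , H +ₚ a , λ s i → begin
  fSeq (G +ₚ X^N) (fSeq F s) i
    ≡⟨ fSeq-+ G X^N (fSeq F s) i ⟩
  fSeq G (fSeq F s) i xor fSeq X^N (fSeq F s) i
    ≡⟨ cong₂ _xor_ (e s i) (X^N∘F s i) ⟩
  (s i xor Tⁿ N s (fSeq (true ∷ H) s) i) xor Tⁿ N s (fSeq F s) i
    ≡⟨ cong₂ (λ u v → (s i xor u) xor v) (Tⁿ-fSeq-∷ N s true H i) (Tⁿ-fSeq-∷ N s true a i) ⟩
  (s i xor (Tⁿ N s s i xor Tⁿ (suc N) s (fSeq H s) i)) xor (Tⁿ N s s i xor Tⁿ (suc N) s (fSeq a s) i)
    ≡⟨ cancel-middle (s i) (Tⁿ N s s i) _ _ ⟩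
  s i xor (Tⁿ (suc N) s (fSeq H s) i xor Tⁿ (suc N) s (fSeq a s) i)
    ≡⟨ cong (s i xor_) (Tⁿ-⊕ (suc N) s (fSeq H s) (fSeq a s) i) ⟨
  s i xor Tⁿ (suc N) s (fSeq H s ⊕ₛ fSeq a s) i
    ≡⟨ cong (s i xor_) (Tⁿ-cong (suc N) s (fSeq-+ H a s) i) ⟨
  s i xor Tⁿ (suc N) s (fSeq (H +ₚ a) s) i
    ∎
  where
  F : Poly
  F = true ∷ a
  N : ℕ
  N = suc k
  X^N : Poly
  X^N = shiftₚ N [ true ]
  X^N∘F : ∀ s → fSeq X^N (fSeq F s) ≗ Tⁿ N s (fSeq F s)
  X^N∘F s i = begin
    fSeq X^N (fSeq F s) i                  ≡⟨ fSeq-∘ X^N a s i ⟩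
    fSeq (X^N *ₚ F) s i                    ≡⟨ cong (λ p → fSeq p s i) (shiftₚ-*ₚ N [ true ] F) ⟩
    fSeq (shiftₚ N ([ true ] *ₚ F)) s i ≡⟨ fSeq-shiftₚ N ([ true ] *ₚ F) s i ⟩
    Tⁿ N s (fSeq ([ true ] *ₚ F) s) i   ≡⟨ Tⁿ-cong N s (λ j → trans (fSeq-+ F [ false ] s j) (fSeq-+0 j)) i ⟩
    Tⁿ N s (fSeq F s) i                    ∎
    where
    fSeq-+0 : ∀ j → fSeq F s j xor fSeq [ false ] s j ≡ fSeq F s j
    fSeq-+0 j = trans (cong (fSeq F s j xor_) (∧-zeroʳ _)) (xor-identityʳ _)

Tⁿ-self-odd : ∀ m {s} → Periodic (suc (2 * m)) s → Tⁿ (suc m) s s ≗ 0ₛ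
Tⁿ-self-odd m {s} p i = begin
  Tⁿ (suc m) s s i
    ≡⟨ Tⁿ-closed (suc m) s s i ⟩
  prodOddₛ (suc m) s i ∧ s (2 * suc m + i)
    ≡⟨ cong₂ _∧_ (prodOddₛ-sucˡ m s i) (trans (cong s (index m i)) (p (suc i))) ⟩
  (not (s (suc i)) ∧ prodOddₛ m s (2 + i)) ∧ s (suc i)
    ≡⟨ contradictory (s (suc i)) _ ⟩
  false
    ∎
  where
  index : ∀ m i → 2 * (1 + m) + i ≡ (1 + 2 * m) + (1 + i)
  index = solve-∀
  contradictory : ∀ a r → (not a ∧ r) ∧ a ≡ false
  contradictory false r = ∧-zeroʳ r
  contradictory true  r = refl

Tⁿ-fSeq-odd : ∀ m {s} → Periodic (suc (2 * m)) s → ∀ H → Tⁿ (suc m) s (fSeq H s) ≗ 0ₛ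
Tⁿ-fSeq-odd m {s} p []      = Tⁿ-0 (suc m) s
Tⁿ-fSeq-odd m {s} p (h ∷ H) i = begin
  Tⁿ (suc m) s (fSeq (h ∷ H) s) i
    ≡⟨ Tⁿ-fSeq-∷ (suc m) s h H i ⟩
  (h ∧ Tⁿ (suc m) s s i) xor T s (Tⁿ (suc m) s (fSeq H s)) i
    ≡⟨ cong₂ (λ u v → (h ∧ u) xor v) (Tⁿ-self-odd m p i) (T-cong s (Tⁿ-fSeq-odd m p H) i) ⟩
  (h ∧ false) xor T s 0ₛ i
    ≡⟨ cong₂ _xor_ (∧-zeroʳ h) (Tⁿ-0 1 s i) ⟩
  false
    ∎

fSeq-left-inverse-odd : ∀ a m → ∃ λ G → ∀ s → Periodic (suc (2 * m)) s → fSeq G (fSeq (true ∷ a) s) ≗ s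
fSeq-left-inverse-odd a m with fSeq-inverse-mod a m
... | G , H , e = G , λ s p i → trans (e s i) (trans (cong (s i xor_) (Tⁿ-fSeq-odd m p H i)) (xor-identityʳ (s i)))

-- Polynomials acting through the shift

actσ : Poly → Seq → Seq
actσ []       u i = false
actσ (c ∷ cs) u i = (c ∧ u i) xor actσ cs u (suc i)

actσ-cong : ∀ p {u v} → u ≗ v → actσ p u ≗ actσ p v
actσ-cong []      e i = refl
actσ-cong (c ∷ p) e i = cong₂ _xor_ (cong (c ∧_) (e i)) (actσ-cong p e (suc i))

actσ-⊕ : ∀ p u v → actσ p (u ⊕ₛ v) ≗ actσ p u ⊕ₛ actσ p v
actσ-⊕ []      u v i = refl
actσ-⊕ (c ∷ p) u v i =
  trans (cong₂ _xor_ (∧-distribˡ-xor c (u i) (v i)) (actσ-⊕ p u v (suc i)))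
        (xor-interchange (c ∧ u i) (c ∧ v i) _ _)

actσ-scale : ∀ p b u i → actσ p (λ j → b ∧ u j) i ≡ b ∧ actσ p u i
actσ-scale []      b u i = sym (∧-zeroʳ b)
actσ-scale (c ∷ p) b u i =
  trans (cong₂ _xor_ (∧-swap c b (u i)) (actσ-scale p b u (suc i)))
        (sym (∧-distribˡ-xor b (c ∧ u i) _))

actσ-0 : ∀ p → actσ p 0ₛ ≗ 0ₛ
actσ-0 []      i = refl
actσ-0 (c ∷ p) i = trans (cong₂ _xor_ (∧-zeroʳ c) (actσ-0 p (suc i))) refl

actσ-1 : ∀ u → actσ [ true ] u ≗ u
actσ-1 u i = xor-identityʳ (u i)

actσ-Xⁿ : ∀ n u i → actσ (replicate n false ++ [ true ]) u i ≡ u (n + i)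
actσ-Xⁿ zero    u i = xor-identityʳ (u i)
actσ-Xⁿ (suc n) u i = trans (actσ-Xⁿ n u (suc i)) (cong u (+-suc n i))

actσ-σ : ∀ p u → actσ p (σ u) ≗ σ (actσ p u)
actσ-σ []      u i = refl
actσ-σ (c ∷ p) u i = cong ((c ∧ u (suc i)) xor_) (actσ-σ p u (suc i))

actσ-+ : ∀ p q u → actσ (p +ₚ q) u ≗ actσ p u ⊕ₛ actσ q u
actσ-+ []      q       u i = refl
actσ-+ (a ∷ p) []      u i = sym (xor-identityʳ _)
actσ-+ (a ∷ p) (b ∷ q) u i =
  trans (cong₂ _xor_ (∧-distribʳ-xor (u i) a b) (actσ-+ p q u (suc i)))
        (xor-interchange (a ∧ u i) (b ∧ u i) _ _)

actσ-*ₚ : ∀ p q u → actσ (p *ₚ q) u ≗ actσ p (actσ q u)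
actσ-*ₚ []      q u i = refl
actσ-*ₚ (b ∷ p) q u i =
  trans (actσ-+ (if b then q else []) (false ∷ (p *ₚ q)) u i)
        (cong₂ _xor_ (scaled b) (actσ-*ₚ p q u (suc i)))
  where
  scaled : ∀ b → actσ (if b then q else []) u i ≡ b ∧ actσ q u i
  scaled true  = refl
  scaled false = refl

actσ-comm : ∀ p q u → actσ p (actσ q u) ≗ actσ q (actσ p u)
actσ-comm []      q u i = sym (actσ-0 q i)
actσ-comm (c ∷ p) q u i = begin
  (c ∧ actσ q u i) xor actσ p (actσ q u) (suc i)
    ≡⟨ cong ((c ∧ actσ q u i) xor_) (trans (actσ-comm p q u (suc i)) (sym (actσ-σ q (actσ p u) i))) ⟩
  (c ∧ actσ q u i) xor actσ q (σ (actσ p u)) i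
    ≡⟨ cong (_xor actσ q (σ (actσ p u)) i) (actσ-scale q c u i) ⟨
  actσ q (λ j → c ∧ u j) i xor actσ q (σ (actσ p u)) i
    ≡⟨ actσ-⊕ q (λ j → c ∧ u j) (σ (actσ p u)) i ⟨
  actσ q (actσ (c ∷ p) u) i
    ∎

actσ-periodic : ∀ p {k u} → Periodic k u → Periodic k (actσ p u)
actσ-periodic []      pu i = refl
actσ-periodic (c ∷ p) {k} {u} pu i =
  cong₂ _xor_ (cong (c ∧_) (pu i)) (trans (cong (actσ p u) (sym (+-suc k i))) (actσ-periodic p pu (suc i)))

actσ-++ : ∀ l l′ u i → actσ (l ++ l′) u i ≡ actσ l u i xor actσ l′ u (length l + i)
actσ-++ []      l′ u i = refl
actσ-++ (c ∷ l) l′ u i = begin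
  (c ∧ u i) xor actσ (l ++ l′) u (suc i)
    ≡⟨ cong ((c ∧ u i) xor_) (actσ-++ l l′ u (suc i)) ⟩
  (c ∧ u i) xor (actσ l u (suc i) xor actσ l′ u (length l + suc i))
    ≡⟨ cong (λ j → (c ∧ u i) xor (actσ l u (suc i) xor actσ l′ u j)) (+-suc (length l) i) ⟩
  (c ∧ u i) xor (actσ l u (suc i) xor actσ l′ u (suc (length l + i)))
    ≡⟨ xor-assoc (c ∧ u i) _ _ ⟨
  actσ (c ∷ l) u i xor actσ l′ u (length (c ∷ l) + i)
    ∎

actσ-norm : ∀ p u → actσ (norm p) u ≗ actσ p u
actσ-norm []      u i = refl
actσ-norm (b ∷ p) u i with norm p in eq
... | []     = trans (lowest b) (cong ((b ∧ u i) xor_) (trans (cong (λ q → actσ q u (suc i)) (sym eq)) (actσ-norm p u (suc i))))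
  where
  lowest : ∀ b → actσ (if b then [ true ] else []) u i ≡ (b ∧ u i) xor false
  lowest true  = refl
  lowest false = refl
... | q ∷ qs = cong ((b ∧ u i) xor_) (trans (cong (λ q → actσ q u (suc i)) (sym eq)) (actσ-norm p u (suc i)))

actσ-≈ : ∀ {p q} → p ≈ₚ q → ∀ u → actσ p u ≗ actσ q u
actσ-≈ {p} {q} e u i = trans (sym (actσ-norm p u i)) (trans (cong (λ r → actσ r u i) e) (actσ-norm q u i))

-- Even periods

interleave : Seq → Seq → Seq
interleave u w zero          = u zero
interleave u w (suc zero)    = w zero
interleave u w (suc (suc i)) = interleave (σ u) (σ w) i

evens odds : Seq → Seq
evens x i = x (2 * i)
odds  x i = x (suc (2 * i))

interleave-cong : ∀ {u u′ w w′} → u ≗ u′ → w ≗ w′ → interleave u w ≗ interleave u′ w′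
interleave-cong eu ew zero          = eu zero
interleave-cong eu ew (suc zero)    = ew zero
interleave-cong eu ew (suc (suc i)) = interleave-cong (eu ∘ suc) (ew ∘ suc) i

private
  2*suc : ∀ i → 2 * suc i ≡ suc (suc (2 * i))
  2*suc i = cong suc (+-suc i (i + 0))

interleave-evens : ∀ u w → evens (interleave u w) ≗ u
interleave-evens u w zero    = refl
interleave-evens u w (suc i) = trans (cong (interleave u w) (2*suc i)) (interleave-evens (σ u) (σ w) i)

interleave-odds : ∀ u w → odds (interleave u w) ≗ w
interleave-odds u w zero    = refl
interleave-odds u w (suc i) = trans (cong (interleave u w ∘ suc) (2*suc i)) (interleave-odds (σ u) (σ w) i)

interleave-evens-odds : ∀ x → interleave (evens x) (odds x) ≗ x
interleave-evens-odds x zero          = refl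
interleave-evens-odds x (suc zero)    = refl
interleave-evens-odds x (suc (suc i)) =
  trans (interleave-cong (λ j → cong x (2*suc j)) (λ j → cong (x ∘ suc) (2*suc j)) i)
        (interleave-evens-odds (σ (σ x)) i)

interleave-injective : ∀ {u u′ w w′} → interleave u w ≗ interleave u′ w′ → u ≗ u′ × w ≗ w′
interleave-injective {u} {u′} {w} {w′} e =
  (λ i → trans (sym (interleave-evens u w i)) (trans (e (2 * i)) (interleave-evens u′ w′ i))) ,
  (λ i → trans (sym (interleave-odds u w i)) (trans (e (suc (2 * i))) (interleave-odds u′ w′ i)))

evens-periodic : ∀ {k x} → Periodic (2 * k) x → Periodic k (evens x)
evens-periodic {k} {x} p i = trans (cong x (*-distribˡ-+ 2 k i)) (p (2 * i))

private
  odds-periodic-index : ∀ k i → suc (2 * (k + i)) ≡ 2 * k + suc (2 * i)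
  odds-periodic-index = solve-∀

odds-periodic : ∀ {k x} → Periodic (2 * k) x → Periodic k (odds x)
odds-periodic {k} {x} p i = trans (cong x (odds-periodic-index k i)) (p (suc (2 * i)))

interleave-periodic : ∀ {k u w} → Periodic k u → Periodic k w → Periodic (2 * k) (interleave u w)
interleave-periodic {k} {u} {w} pu pw i =
  trans (sym (interleave-evens-odds shifted i)) (interleave-cong evens-shifted odds-shifted i)
  where
  shifted : Seq
  shifted j = interleave u w (2 * k + j)
  evens-shifted : evens shifted ≗ u
  evens-shifted j = begin
    interleave u w (2 * k + 2 * j)   ≡⟨ cong (interleave u w) (*-distribˡ-+ 2 k j) ⟨
    interleave u w (2 * (k + j))     ≡⟨ interleave-evens u w (k + j) ⟩
    u (k + j)                        ≡⟨ pu j ⟩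
    u j                              ∎
  odds-shifted : odds shifted ≗ w
  odds-shifted j = begin
    interleave u w (2 * k + suc (2 * j)) ≡⟨ cong (interleave u w) (odds-periodic-index k j) ⟨
    interleave u w (suc (2 * (k + j)))   ≡⟨ interleave-odds u w (k + j) ⟩
    w (k + j)                            ≡⟨ pw j ⟩
    w j                                  ∎

interleave-0 : interleave 0ₛ 0ₛ ≗ 0ₛ
interleave-0 zero          = refl
interleave-0 (suc zero)    = refl
interleave-0 (suc (suc i)) = interleave-0 i

private
  step-interleave-evens : ∀ c u v j →
    (c ∧ interleave u 0ₛ j) xor (not (interleave u 0ₛ (suc j)) ∧ interleave v 0ₛ (2 + j))
      ≡ interleave (λ i → (c ∧ u i) xor v (suc i)) 0ₛ j
  step-interleave-evens c u v zero          = refl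
  step-interleave-evens c u v (suc zero)    = trans (cong (_xor _) (∧-zeroʳ c)) (∧-zeroʳ _)
  step-interleave-evens c u v (suc (suc j)) = step-interleave-evens c (σ u) (σ v) j

  step-interleave-odds : ∀ c w v j →
    (c ∧ interleave 0ₛ w j) xor (not (interleave 0ₛ w (suc j)) ∧ interleave 0ₛ v (2 + j))
      ≡ interleave 0ₛ (λ i → (c ∧ w i) xor v (suc i)) j
  step-interleave-odds c w v zero          = trans (cong (_xor _) (∧-zeroʳ c)) (∧-zeroʳ _)
  step-interleave-odds c w v (suc zero)    = refl
  step-interleave-odds c w v (suc (suc j)) = step-interleave-odds c (σ w) (σ v) j

fSeq-interleave-evens : ∀ C u → fSeq C (interleave u 0ₛ) ≗ interleave (actσ C u) 0ₛ
fSeq-interleave-evens []      u j = sym (interleave-0 j)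
fSeq-interleave-evens (c ∷ C) u j =
  trans (cong (λ z → (c ∧ interleave u 0ₛ j) xor (not (interleave u 0ₛ (suc j)) ∧ z)) (fSeq-interleave-evens C u (2 + j)))
        (step-interleave-evens c u (actσ C u) j)

fSeq-interleave-odds : ∀ C w → fSeq C (interleave 0ₛ w) ≗ interleave 0ₛ (actσ C w)
fSeq-interleave-odds []      w j = sym (interleave-0 j)
fSeq-interleave-odds (c ∷ C) w j =
  trans (cong (λ z → (c ∧ interleave 0ₛ w j) xor (not (interleave 0ₛ w (suc j)) ∧ z)) (fSeq-interleave-odds C w (2 + j)))
        (step-interleave-odds c w (actσ C w) j)

SingleParity : Seq → Set
SingleParity x = evens x ≗ 0ₛ ⊎ odds x ≗ 0ₛ

Mixed : Seq → Set
Mixed x = (∃ λ e → x (2 * e) ≡ true) × (∃ λ o → x (suc (2 * o)) ≡ true)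

singleParity⊎mixed : ∀ {k x} → Periodic (2 * suc k) x → SingleParity x ⊎ Mixed x
singleParity⊎mixed {k} {x} p with periodic-≗0⊎nonzero (evens-periodic {suc k} {x} p) | periodic-≗0⊎nonzero (odds-periodic {suc k} {x} p)
... | inj₁ e | _      = inj₁ (inj₁ e)
... | inj₂ _ | inj₁ o = inj₁ (inj₂ o)
... | inj₂ e | inj₂ o = inj₂ (e , o)

mixed⇒¬singleParity : ∀ {x} → Mixed x → ¬ SingleParity x
mixed⇒¬singleParity ((e , xe) , _) (inj₁ none) with trans (sym xe) (none e)
... | ()
mixed⇒¬singleParity (_ , (o , xo)) (inj₂ none) with trans (sym xo) (none o)
... | ()

singleParity-cong : ∀ {x y} → x ≗ y → SingleParity x → SingleParity y
singleParity-cong e (inj₁ none) = inj₁ λ i → trans (sym (e (2 * i))) (none i)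
singleParity-cong e (inj₂ none) = inj₂ λ i → trans (sym (e (suc (2 * i)))) (none i)

actσ-≗0 : ∀ C {u} → u ≗ 0ₛ → actσ C u ≗ 0ₛ
actσ-≗0 C u≗0 i = trans (actσ-cong C u≗0 i) (actσ-0 C i)

fSeq-singleParity : ∀ C {x} → SingleParity x → fSeq C x ≗ interleave (actσ C (evens x)) (actσ C (odds x))
fSeq-singleParity C {x} (inj₁ none) j = begin
  fSeq C x j                                        ≡⟨ fSeq-cong C x≗ j ⟩
  fSeq C (interleave 0ₛ (odds x)) j                 ≡⟨ fSeq-interleave-odds C (odds x) j ⟩
  interleave 0ₛ (actσ C (odds x)) j                 ≡⟨ interleave-cong (λ i → sym (actσ-≗0 C none i)) (λ _ → refl) j ⟩
  interleave (actσ C (evens x)) (actσ C (odds x)) j ∎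
  where
  x≗ : x ≗ interleave 0ₛ (odds x)
  x≗ i = trans (sym (interleave-evens-odds x i)) (interleave-cong none (λ _ → refl) i)
fSeq-singleParity C {x} (inj₂ none) j = begin
  fSeq C x j                                        ≡⟨ fSeq-cong C x≗ j ⟩
  fSeq C (interleave (evens x) 0ₛ) j                ≡⟨ fSeq-interleave-evens C (evens x) j ⟩
  interleave (actσ C (evens x)) 0ₛ j                ≡⟨ interleave-cong (λ _ → refl) (λ i → sym (actσ-≗0 C none i)) j ⟩
  interleave (actσ C (evens x)) (actσ C (odds x)) j ∎
  where
  x≗ : x ≗ interleave (evens x) 0ₛ
  x≗ i = trans (sym (interleave-evens-odds x i)) (interleave-cong (λ _ → refl) none i)

fSeq-singleParity-closed : ∀ C {x} → SingleParity x → SingleParity (fSeq C x)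
fSeq-singleParity-closed C {x} sx@(inj₁ none) = inj₁ λ i →
  trans (fSeq-singleParity C sx (2 * i)) (trans (interleave-evens _ _ i) (actσ-≗0 C none i))
fSeq-singleParity-closed C {x} sx@(inj₂ none) = inj₂ λ i →
  trans (fSeq-singleParity C sx (suc (2 * i))) (trans (interleave-odds _ _ i) (actσ-≗0 C none i))

module _ {k s} (p : Periodic (2 * suc k) s) where

  prodOddₛ-+2 : ∀ i → prodOddₛ (suc k) s (2 + i) ≡ prodOddₛ (suc k) s i
  prodOddₛ-+2 i = begin
    not (s (2 * k + 1 + (2 + i))) ∧ prodOddₛ k s (2 + i)  ≡⟨ cong (λ j → not (s j) ∧ prodOddₛ k s (2 + i)) (index k i) ⟩
    not (s (2 * suc k + suc i)) ∧ prodOddₛ k s (2 + i)    ≡⟨ cong (λ b → not b ∧ prodOddₛ k s (2 + i)) (p (suc i)) ⟩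
    not (s (suc i)) ∧ prodOddₛ k s (2 + i)                ≡⟨ prodOddₛ-sucˡ k s i ⟨
    prodOddₛ (suc k) s i                                  ∎
    where
    index : ∀ k i → 2 * k + 1 + (2 + i) ≡ 2 * (1 + k) + (1 + i)
    index = solve-∀

  prodOddₛ-+2* : ∀ t i → prodOddₛ (suc k) s (2 * t + i) ≡ prodOddₛ (suc k) s i
  prodOddₛ-+2* zero    i = refl
  prodOddₛ-+2* (suc t) i = trans (cong (prodOddₛ (suc k) s) (index t i)) (trans (prodOddₛ-+2 (2 * t + i)) (prodOddₛ-+2* t i))
    where
    index : ∀ t i → 2 * (1 + t) + i ≡ 2 + (2 * t + i)
    index = solve-∀

  private
    prodOddₛ-hit : ∀ i → s (suc i) ≡ true → prodOddₛ (suc k) s i ≡ false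
    prodOddₛ-hit i e = trans (prodOddₛ-sucˡ k s i) (cong (λ b → not b ∧ prodOddₛ k s (2 + i)) e)

  -- A period-2(k+1) sequence with 1s at both parities meets every window of k+1 odd offsets.
  prodOddₛ-mixed : Mixed s → ∀ i → prodOddₛ (suc k) s i ≡ false
  prodOddₛ-mixed ((e , se) , (o , so)) i with evenOdd i
  ... | even a = begin
    prodOddₛ (suc k) s (2 * a)           ≡⟨ prodOddₛ-+2* o (2 * a) ⟨
    prodOddₛ (suc k) s (2 * o + 2 * a)   ≡⟨ cong (prodOddₛ (suc k) s) (+-comm (2 * o) (2 * a)) ⟩
    prodOddₛ (suc k) s (2 * a + 2 * o)   ≡⟨ prodOddₛ-+2* a (2 * o) ⟩
    prodOddₛ (suc k) s (2 * o)           ≡⟨ prodOddₛ-hit (2 * o) so ⟩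
    false                                ∎
  ... | odd a = begin
    prodOddₛ (suc k) s (suc (2 * a))           ≡⟨ prodOddₛ-+2* (e + k) (suc (2 * a)) ⟨
    prodOddₛ (suc k) s (2 * (e + k) + suc (2 * a)) ≡⟨ cong (prodOddₛ (suc k) s) (swap e k a) ⟩
    prodOddₛ (suc k) s (2 * a + suc (2 * (e + k))) ≡⟨ prodOddₛ-+2* a (suc (2 * (e + k))) ⟩
    prodOddₛ (suc k) s (suc (2 * (e + k)))     ≡⟨ prodOddₛ-hit _ (trans (cong s (wrap e k)) (trans (p (2 * e)) se)) ⟩
    false                                      ∎
    where
    swap : ∀ e k a → 2 * (e + k) + suc (2 * a) ≡ 2 * a + suc (2 * (e + k))
    swap = solve-∀
    wrap : ∀ e k → 2 + 2 * (e + k) ≡ 2 * suc k + 2 * e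
    wrap = solve-∀

  Tⁿ-mixed : Mixed s → ∀ v → Tⁿ (suc k) s v ≗ 0ₛ
  Tⁿ-mixed m v i = trans (Tⁿ-closed (suc k) s v i) (cong (_∧ v (2 * suc k + i)) (prodOddₛ-mixed m i))

fSeq-left-inverse-mixed : ∀ a k → ∃ λ G → ∀ s → Periodic (2 * suc k) s → Mixed s → fSeq G (fSeq (true ∷ a) s) ≗ s
fSeq-left-inverse-mixed a k with fSeq-inverse-mod a k
... | G , H , e = G , λ s p m i → trans (e s i) (trans (cong (s i xor_) (Tⁿ-mixed p m (fSeq H s) i)) (xor-identityʳ (s i)))

KernelFree : Poly → ℕ → Set
KernelFree F K = ∀ u → Periodic K u → actσ F u ≗ 0ₛ → u ≗ 0ₛ

actσ-injective : ∀ {F K u v} → KernelFree F K → Periodic K u → Periodic K v → actσ F u ≗ actσ F v → u ≗ v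
actσ-injective {F} {K} {u} {v} free pu pv e i = xor≡false⇒≡ (free (u ⊕ₛ v) (λ j → cong₂ _xor_ (pu j) (pv j)) kills i)
  where
  kills : actσ F (u ⊕ₛ v) ≗ 0ₛ
  kills j = trans (actσ-⊕ F u v j) (trans (cong (_xor actσ F v j) (e j)) (xor-same (actσ F v j)))

module _ {a k} (free : KernelFree (true ∷ a) (suc k)) where

  private
    F : Poly
    F = true ∷ a

  singleParity-injective : ∀ {x x′} → Periodic (2 * suc k) x → Periodic (2 * suc k) x′ →
    SingleParity x → SingleParity x′ → fSeq F x ≗ fSeq F x′ → x ≗ x′
  singleParity-injective {x} {x′} px px′ sx sx′ e i = begin
    x i                                         ≡⟨ interleave-evens-odds x i ⟨
    interleave (evens x) (odds x) i             ≡⟨ interleave-cong same-evens same-odds i ⟩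
    interleave (evens x′) (odds x′) i           ≡⟨ interleave-evens-odds x′ i ⟩
    x′ i                                        ∎
    where
    images : actσ F (evens x) ≗ actσ F (evens x′) × actσ F (odds x) ≗ actσ F (odds x′)
    images = interleave-injective λ j →
      trans (sym (fSeq-singleParity F {x} sx j)) (trans (e j) (fSeq-singleParity F {x′} sx′ j))
    same-evens : evens x ≗ evens x′
    same-evens = actσ-injective {F} {suc k} free (evens-periodic {suc k} px) (evens-periodic {suc k} px′) (proj₁ images)
    same-odds : odds x ≗ odds x′
    same-odds = actσ-injective {F} {suc k} free (odds-periodic {suc k} px) (odds-periodic {suc k} px′) (proj₂ images)

  fSeq-injective-even : ∀ {x x′} → Periodic (2 * suc k) x → Periodic (2 * suc k) x′ → fSeq F x ≗ fSeq F x′ → x ≗ x′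
  fSeq-injective-even {x} {x′} px px′ e with fSeq-left-inverse-mixed a k | singleParity⊎mixed px | singleParity⊎mixed px′
  ... | _ , inv | inj₁ sx | inj₁ sx′ = singleParity-injective px px′ sx sx′ e
  ... | G , inv | inj₂ mx | inj₂ mx′ = λ i →
    trans (sym (inv x px mx i)) (trans (fSeq-cong G e i) (inv x′ px′ mx′ i))
  ... | G , inv | inj₂ mx | inj₁ sx′ = ⊥-elim (mixed⇒¬singleParity {x} mx (singleParity-cong
    (λ i → trans (sym (fSeq-cong G e i)) (inv x px mx i))
    (fSeq-singleParity-closed G (fSeq-singleParity-closed F {x′} sx′))))
  ... | G , inv | inj₁ sx | inj₂ mx′ = ⊥-elim (mixed⇒¬singleParity {x′} mx′ (singleParity-cong
    (λ i → trans (fSeq-cong G e i) (inv x′ px′ mx′ i))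
    (fSeq-singleParity-closed G (fSeq-singleParity-closed F {x} sx))))

-- Finite enumeration of F₂ⁿ

private
  bit : Bool → Fin 2
  bit false = zero
  bit true  = suc zero

  unbit : Fin 2 → Bool
  unbit zero       = false
  unbit (suc zero) = true

  unbit-bit : ∀ b → unbit (bit b) ≡ b
  unbit-bit false = refl
  unbit-bit true  = refl

  bit-unbit : ∀ i → bit (unbit i) ≡ i
  bit-unbit zero       = refl
  bit-unbit (suc zero) = refl

encode : ∀ {n} → Vec Bool n → Fin (2 ^ n)
encode []      = zero
encode (b ∷ v) = combine (bit b) (encode v)

decode : ∀ {n} → Fin (2 ^ n) → Vec Bool n
decode {zero}  _ = []
decode {suc n} i = unbit (proj₁ (remQuot (2 ^ n) i)) ∷ decode (proj₂ (remQuot {2} (2 ^ n) i))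

decode-encode : ∀ {n} (v : Vec Bool n) → decode (encode v) ≡ v
decode-encode []              = refl
decode-encode {suc n} (b ∷ v) =
  trans (cong (λ (i , j) → unbit i ∷ decode j) (remQuot-combine {2} {2 ^ n} (bit b) (encode v)))
        (cong₂ _∷_ (unbit-bit b) (decode-encode v))

encode-decode : ∀ n (i : Fin (2 ^ n)) → encode (decode {n} i) ≡ i
encode-decode zero    zero = refl
encode-decode (suc n) i    =
  trans (cong₂ combine (bit-unbit (proj₁ (remQuot {2} (2 ^ n) i))) (encode-decode n (proj₂ (remQuot {2} (2 ^ n) i))))
        (combine-remQuot {2} (2 ^ n) i)

∃-Vec? : ∀ {n} {P : Vec Bool n → Set} → (∀ v → Dec (P v)) → Dec (∃ P)
∃-Vec? {n} {P} P? = Dec.map′ (λ (i , p) → decode i , p)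
                             (λ (v , p) → encode v , subst P (sym (decode-encode v)) p)
                             (any? (P? ∘ decode))

Fin-injective⇒surjective : ∀ {N} (h : Fin N → Fin N) → Injective _≡_ _≡_ h → StrictlySurjective _≡_ h
Fin-injective⇒surjective {zero}  h inj ()
Fin-injective⇒surjective {suc N} h inj y with any? (λ x → h x Fin.≟ y)
... | yes hit  = hit
... | no  miss = contradiction (injective⇒≤ {f = h′} h′-injective) (n≮n N)
  where
  h′ : Fin (suc N) → Fin N
  h′ x = punchOut {i = y} {j = h x} (λ e → miss (x , sym e))
  h′-injective : Injective _≡_ _≡_ h′
  h′-injective {x} {z} e = inj (punchOut-injective (λ e′ → miss (x , sym e′)) (λ e′ → miss (z , sym e′)) e)

Vec-injective⇒permutation : ∀ {n} (f : Vec Bool n → Vec Bool n) → Injective _≡_ _≡_ f → IsPermutation f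
Vec-injective⇒permutation {n} f inj = inj , strictlySurjective⇒surjective onto
  where
  h : Fin (2 ^ n) → Fin (2 ^ n)
  h = encode ∘ f ∘ decode
  h-injective : Injective _≡_ _≡_ h
  h-injective {i} {j} e = trans (sym (encode-decode n i))
    (trans (cong encode (inj (trans (sym (decode-encode (f (decode i)))) (trans (cong decode e) (decode-encode (f (decode j)))))))
           (encode-decode n j))
  onto : StrictlySurjective _≡_ f
  onto y with Fin-injective⇒surjective h h-injective (encode y)
  ... | i , e = decode i , trans (sym (decode-encode (f (decode i)))) (trans (cong decode e) (decode-encode y))

HasPeriodicKernel : Poly → ℕ → Set
HasPeriodicKernel F K = ∃ λ w → Periodic K w × (∃ λ i → w i ≡ true) × actσ F w ≗ 0ₛ

fMap-injective : ∀ {m} a →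
  (∀ {x y} → Periodic (suc m) x → Periodic (suc m) y → fSeq (true ∷ a) x ≗ fSeq (true ∷ a) y → x ≗ y) →
  Injective _≡_ _≡_ (fMap a {suc m})
fMap-injective a inj {x} {y} e = toSeq-injective (inj (toSeq-periodic x) (toSeq-periodic y) λ i →
  trans (sym (toSeq-fMap x a i)) (trans (cong (λ z → toSeq z i) e) (toSeq-fMap y a i)))

fMap-permutation-odd : ∀ a m → IsPermutation (fMap a {suc (2 * m)})
fMap-permutation-odd a m with fSeq-left-inverse-odd a m
... | G , inv = Vec-injective⇒permutation (fMap a) (fMap-injective a λ {x} {y} px py e i →
  trans (sym (inv x px i)) (trans (fSeq-cong G e i) (inv y py i)))

fMap-permutation-even : ∀ a k → KernelFree (true ∷ a) (suc k) → IsPermutation (fMap a {2 * suc k})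
fMap-permutation-even a k free = Vec-injective⇒permutation (fMap a) (fMap-injective a (fSeq-injective-even {a} {k} free))

fMap-not-permutation : ∀ a k → HasPeriodicKernel (true ∷ a) (suc k) → ¬ IsPermutation (fMap a {2 * suc k})
fMap-not-permutation a k (w , pw , (i , wi) , kernel) (inj , _) = contradiction (begin
    true                    ≡⟨ wi ⟨
    w i                     ≡⟨ interleave-evens w 0ₛ i ⟨
    x (2 * i)               ≡⟨ toSeq-fromSeq px (2 * i) ⟨
    toSeq X (2 * i)         ≡⟨ cong (λ v → toSeq v (2 * i)) (inj collapses) ⟩
    toSeq 𝟘 (2 * i)         ≡⟨ toSeq-replicate false (2 * i) ⟩
    false                   ∎) λ ()
  where
  x : Seq
  x = interleave w 0ₛ
  X : Vec Bool (2 * suc k)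
  X = fromSeq x
  px : Periodic (2 * suc k) x
  px = interleave-periodic {suc k} pw (λ _ → refl)
  collapses : fMap a X ≡ fMap a 𝟘
  collapses = toSeq-injective λ j → begin
    toSeq (fMap a X) j                  ≡⟨ toSeq-fMap X a j ⟩
    fSeq (true ∷ a) (toSeq X) j         ≡⟨ fSeq-cong (true ∷ a) (toSeq-fromSeq px) j ⟩
    fSeq (true ∷ a) x j                 ≡⟨ fSeq-interleave-evens (true ∷ a) w j ⟩
    interleave (actσ (true ∷ a) w) 0ₛ j ≡⟨ interleave-cong kernel (λ _ → refl) j ⟩
    interleave 0ₛ 0ₛ j                  ≡⟨ interleave-0 j ⟩
    false                               ≡⟨ fSeq-0 (true ∷ a) j ⟨
    fSeq (true ∷ a) 0ₛ j                ≡⟨ fSeq-cong (true ∷ a) (toSeq-replicate false) j ⟨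
    fSeq (true ∷ a) (toSeq 𝟘) j         ≡⟨ toSeq-fMap 𝟘 a j ⟨
    toSeq (fMap a 𝟘) j                  ∎

kernelFree⊎hasPeriodicKernel : ∀ F k → KernelFree F (suc k) ⊎ HasPeriodicKernel F (suc k)
kernelFree⊎hasPeriodicKernel F k
  with ∃-Vec? (λ u → ¬? (≡-dec Bool._≟_ u 𝟘) ×-dec all? (λ j → actσ F (toSeq u) (toℕ j) Bool.≟ false))
... | yes (u , u≢𝟘 , zeros) =
  inj₂ (toSeq u , toSeq-periodic u , nonzero , periodic-≗0 (actσ-periodic F (toSeq-periodic u)) zeros)
  where
  nonzero : ∃ λ i → toSeq u i ≡ true
  nonzero with periodic-≗0⊎nonzero (toSeq-periodic u)
  ... | inj₁ z  = contradiction (toSeq-injective λ i → trans (z i) (sym (toSeq-replicate false i))) u≢𝟘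
  ... | inj₂ nz = nz
... | no none = inj₁ free
  where
  free : KernelFree F (suc k)
  free w pw kernel with periodic-≗0⊎nonzero pw
  ... | inj₁ z        = z
  ... | inj₂ (i , wᵢ) = contradiction (fromSeq w , W≢𝟘 , W-kernel) none
    where
    W≢𝟘 : ¬ fromSeq {k} w ≡ 𝟘
    W≢𝟘 W≡𝟘 = contradiction (begin
      true                  ≡⟨ wᵢ ⟨
      w i                   ≡⟨ toSeq-fromSeq pw i ⟨
      toSeq (fromSeq w) i   ≡⟨ cong (λ v → toSeq v i) W≡𝟘 ⟩
      toSeq 𝟘 i             ≡⟨ toSeq-replicate false i ⟩
      false                 ∎) λ ()
    W-kernel : ∀ (j : Fin (suc k)) → actσ F (toSeq (fromSeq w)) (toℕ j) ≡ false
    W-kernel j = trans (actσ-cong F (toSeq-fromSeq pw) (toℕ j)) (kernel (toℕ j))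

fMap-not-permutation⇔ : ∀ a n → n ≥ 1 →
  (¬ IsPermutation (fMap a {n})) ⇔ (∃ λ K → 2 * K ∣ n × HasPeriodicKernel (true ∷ a) K)
fMap-not-permutation⇔ a n n≥1 = mk⇔ to from
  where
  to : ¬ IsPermutation (fMap a {n}) → ∃ λ K → 2 * K ∣ n × HasPeriodicKernel (true ∷ a) K
  to np with evenOdd n
  ... | odd m       = contradiction (fMap-permutation-odd a m) np
  ... | even zero   = contradiction n≥1 λ ()
  ... | even (suc k) with kernelFree⊎hasPeriodicKernel (true ∷ a) k
  ...   | inj₁ free = contradiction (fMap-permutation-even a k free) np
  ...   | inj₂ ker  = suc k , ∣-refl , ker

  from : (∃ λ K → 2 * K ∣ n × HasPeriodicKernel (true ∷ a) K) → ¬ IsPermutation (fMap a {n})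
  from (K , divides q n≡q*2K , w , pw , nz , kernel) = by-cases (q * K) refl
    where
    regroup : ∀ q K → q * (2 * K) ≡ 2 * (q * K)
    regroup = solve-∀
    by-cases : ∀ N → q * K ≡ N → ¬ IsPermutation (fMap a {n})
    by-cases zero    e = contradiction (subst (_≥ 1) (trans n≡q*2K (trans (regroup q K) (cong (2 *_) e))) n≥1) λ ()
    by-cases (suc k) e = subst (λ n → ¬ IsPermutation (fMap a {n}))
      (sym (trans n≡q*2K (trans (regroup q K) (cong (2 *_) e))))
      (fMap-not-permutation a k (w , subst (λ P → Periodic P w) e (periodic-* q pw) , nz , kernel))

coef : Poly → ℕ → Bool
coef []      i       = false
coef (b ∷ p) zero    = b
coef (b ∷ p) (suc i) = coef p i

private
  consₙ : Bool → Poly → Poly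
  consₙ b []       = if b then [ true ] else []
  consₙ b (x ∷ xs) = b ∷ x ∷ xs

  norm-∷ : ∀ b p → norm (b ∷ p) ≡ consₙ b (norm p)
  norm-∷ b p with norm p
  ... | []     = refl
  ... | x ∷ xs = refl

  coef-consₙ : ∀ b l → coef (consₙ b l) ≗ coef (b ∷ l)
  coef-consₙ true  []      zero    = refl
  coef-consₙ true  []      (suc i) = refl
  coef-consₙ false []      zero    = refl
  coef-consₙ false []      (suc i) = refl
  coef-consₙ b     (x ∷ l) i       = refl

coef-norm : ∀ p → coef (norm p) ≗ coef p
coef-norm []      i       = refl
coef-norm (b ∷ p) i = trans (cong (λ q → coef q i) (norm-∷ b p)) (trans (coef-consₙ b (norm p) i) (tail i))
  where
  tail : ∀ i → coef (b ∷ norm p) i ≡ coef (b ∷ p) i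
  tail zero    = refl
  tail (suc i) = coef-norm p i

≈ₚ⇒coef : ∀ {p q} → p ≈ₚ q → coef p ≗ coef q
≈ₚ⇒coef {p} {q} e i = trans (sym (coef-norm p i)) (trans (cong (λ r → coef r i) e) (coef-norm q i))

coef⇒≈ₚ : ∀ p q → coef p ≗ coef q → p ≈ₚ q
coef⇒≈ₚ []      []       e = refl
coef⇒≈ₚ []      (b ∷ q)  e = sym (trans (norm-∷ b q) (cong₂ consₙ (sym (e zero)) (sym (coef⇒≈ₚ [] q (λ i → e (suc i))))))
coef⇒≈ₚ (b ∷ p) []       e = trans (norm-∷ b p) (cong₂ consₙ (e zero) (coef⇒≈ₚ p [] (λ i → e (suc i))))
coef⇒≈ₚ (b ∷ p) (b′ ∷ q) e =
  trans (norm-∷ b p) (trans (cong₂ consₙ (e zero) (coef⇒≈ₚ p q (λ i → e (suc i)))) (sym (norm-∷ b′ q)))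

coef-+ₚ : ∀ p q i → coef (p +ₚ q) i ≡ coef p i xor coef q i
coef-+ₚ []      q       i       = refl
coef-+ₚ (a ∷ p) []      i       = sym (xor-identityʳ _)
coef-+ₚ (a ∷ p) (b ∷ q) zero    = refl
coef-+ₚ (a ∷ p) (b ∷ q) (suc i) = coef-+ₚ p q i

coef-*ₚ-∷ : ∀ b p q i → coef ((b ∷ p) *ₚ q) i ≡ (b ∧ coef q i) xor coef (false ∷ (p *ₚ q)) i
coef-*ₚ-∷ b p q i = trans (coef-+ₚ (if b then q else []) (false ∷ (p *ₚ q)) i) (cong (_xor _) (scaled b))
  where
  scaled : ∀ b → coef (if b then q else []) i ≡ b ∧ coef q i
  scaled true  = refl
  scaled false = refl

coef-*ₚ-zeroˡ : ∀ p q → (∀ i → coef p i ≡ false) → ∀ i → coef (p *ₚ q) i ≡ false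
coef-*ₚ-zeroˡ []      q z i = refl
coef-*ₚ-zeroˡ (b ∷ p) q z i = trans (coef-*ₚ-∷ b p q i) (cong₂ (λ c r → (c ∧ coef q i) xor r) (z zero) (shifted i))
  where
  shifted : ∀ i → coef (false ∷ (p *ₚ q)) i ≡ false
  shifted zero    = refl
  shifted (suc i) = coef-*ₚ-zeroˡ p q (λ j → z (suc j)) i

coef-*ₚ-congˡ : ∀ p p′ q → coef p ≗ coef p′ → coef (p *ₚ q) ≗ coef (p′ *ₚ q)
coef-*ₚ-congˡ []      p′       q e i = sym (coef-*ₚ-zeroˡ p′ q (λ j → sym (e j)) i)
coef-*ₚ-congˡ (b ∷ p) []       q e i = coef-*ₚ-zeroˡ (b ∷ p) q e i
coef-*ₚ-congˡ (b ∷ p) (b′ ∷ p′) q e i = begin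
  coef ((b ∷ p) *ₚ q) i                                  ≡⟨ coef-*ₚ-∷ b p q i ⟩
  (b ∧ coef q i) xor coef (false ∷ (p *ₚ q)) i           ≡⟨ cong₂ (λ c r → (c ∧ coef q i) xor r) (e zero) (shifted i) ⟩
  (b′ ∧ coef q i) xor coef (false ∷ (p′ *ₚ q)) i         ≡⟨ coef-*ₚ-∷ b′ p′ q i ⟨
  coef ((b′ ∷ p′) *ₚ q) i                                ∎
  where
  shifted : ∀ i → coef (false ∷ (p *ₚ q)) i ≡ coef (false ∷ (p′ *ₚ q)) i
  shifted zero    = refl
  shifted (suc i) = coef-*ₚ-congˡ p p′ q (λ j → e (suc j)) i

coef-1*ₚ : ∀ h → coef ([ true ] *ₚ h) ≗ coef h
coef-1*ₚ h i = trans (coef-*ₚ-∷ true [] h i) (trans (cong (coef h i xor_) (zero-tail i)) (xor-identityʳ _))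
  where
  zero-tail : ∀ i → coef [ false ] i ≡ false
  zero-tail zero    = refl
  zero-tail (suc i) = refl

norm≡[]⊎monic : ∀ p → norm p ≡ [] ⊎ ∃ λ l → norm p ≡ l ++ [ true ]
norm≡[]⊎monic []      = inj₁ refl
norm≡[]⊎monic (b ∷ p) with norm≡[]⊎monic p
... | inj₂ (l , e) = inj₂ (consₙ-monic l , trans (norm-∷ b p) (trans (cong (consₙ b) e) (consₙ-++ l)))
  where
  consₙ-monic : Poly → Poly
  consₙ-monic []      = [ b ]
  consₙ-monic (x ∷ l) = b ∷ x ∷ l
  consₙ-++ : ∀ l → consₙ b (l ++ [ true ]) ≡ consₙ-monic l ++ [ true ]
  consₙ-++ []      = refl
  consₙ-++ (x ∷ l) = refl
... | inj₁ e = constant b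
  where
  constant : ∀ b → norm (b ∷ p) ≡ [] ⊎ ∃ λ l → norm (b ∷ p) ≡ l ++ [ true ]
  constant true  = inj₂ ([] , trans (norm-∷ true p) (cong (consₙ true) e))
  constant false = inj₁ (trans (norm-∷ false p) (cong (consₙ false) e))

norm-monic : ∀ l → norm (l ++ [ true ]) ≡ l ++ [ true ]
norm-monic []          = refl
norm-monic (b ∷ [])    = refl
norm-monic (b ∷ x ∷ l) = trans (norm-∷ b (x ∷ l ++ [ true ])) (cong (consₙ b) (norm-monic (x ∷ l)))

length-monic : ∀ (l : Poly) → length (l ++ [ true ]) ∸ 1 ≡ length l
length-monic l = cong (_∸ 1) (trans (length-++ l) (+-comm (length l) 1))

deg-monic : ∀ l → deg (l ++ [ true ]) ≡ length l
deg-monic l = trans (cong (λ q → length q ∸ 1) (norm-monic l)) (length-monic l)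

deg≡0⇒norm : ∀ q → deg q ≡ 0 → norm q ≡ [] ⊎ norm q ≡ [ true ]
deg≡0⇒norm q d with norm≡[]⊎monic q
... | inj₁ e = inj₁ e
... | inj₂ ([] , e) = inj₂ e
... | inj₂ (x ∷ l , e) with trans (sym (length-monic (x ∷ l))) (trans (cong (λ r → length r ∸ 1) (sym e)) d)
... | ()

coef-monic-top : ∀ l → coef (l ++ [ true ]) (length l) ≡ true
coef-monic-top []      = refl
coef-monic-top (b ∷ l) = coef-monic-top l

coef-monic-beyond : ∀ l i → length l < i → coef (l ++ [ true ]) i ≡ false
coef-monic-beyond []      (suc i) _         = refl
coef-monic-beyond (b ∷ l) (suc i) (s≤s lt) = coef-monic-beyond l i lt

infix 25 _·_

_·_ : ∀ {n} → Bool → Vec Bool n → Vec Bool n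
b · v = if b then v else 𝟘

⊕-assoc : ∀ {n} (u v w : Vec Bool n) → (u ⊕ v) ⊕ w ≡ u ⊕ (v ⊕ w)
⊕-assoc []      []      []      = refl
⊕-assoc (a ∷ u) (b ∷ v) (c ∷ w) = cong₂ _∷_ (xor-assoc a b c) (⊕-assoc u v w)

⊕-comm : ∀ {n} (u v : Vec Bool n) → u ⊕ v ≡ v ⊕ u
⊕-comm []      []      = refl
⊕-comm (a ∷ u) (b ∷ v) = cong₂ _∷_ (xor-comm a b) (⊕-comm u v)

⊕-identityˡ : ∀ {n} (u : Vec Bool n) → 𝟘 ⊕ u ≡ u
⊕-identityˡ []      = refl
⊕-identityˡ (a ∷ u) = cong (a ∷_) (⊕-identityˡ u)

⊕-identityʳ : ∀ {n} (u : Vec Bool n) → u ⊕ 𝟘 ≡ u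
⊕-identityʳ u = trans (⊕-comm u 𝟘) (⊕-identityˡ u)

⊕-self : ∀ {n} (u : Vec Bool n) → u ⊕ u ≡ 𝟘
⊕-self []      = refl
⊕-self (a ∷ u) = cong₂ _∷_ (xor-same a) (⊕-self u)

⊕-interchange : ∀ {n} (a b c d : Vec Bool n) → (a ⊕ b) ⊕ (c ⊕ d) ≡ (a ⊕ c) ⊕ (b ⊕ d)
⊕-interchange []       []       []       []       = refl
⊕-interchange (a ∷ as) (b ∷ bs) (c ∷ cs) (d ∷ ds) = cong₂ _∷_ (xor-interchange a b c d) (⊕-interchange as bs cs ds)

⊕≡𝟘⇒≡ : ∀ {n} {u v : Vec Bool n} → u ⊕ v ≡ 𝟘 → u ≡ v
⊕≡𝟘⇒≡ {u = u} {v} e = begin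
  u                ≡⟨ ⊕-identityʳ u ⟨
  u ⊕ 𝟘            ≡⟨ cong (u ⊕_) (⊕-self v) ⟨
  u ⊕ (v ⊕ v)      ≡⟨ ⊕-assoc u v v ⟨
  (u ⊕ v) ⊕ v      ≡⟨ cong (_⊕ v) e ⟩
  𝟘 ⊕ v            ≡⟨ ⊕-identityˡ v ⟩
  v                ∎

·-xor : ∀ {n} a b (v : Vec Bool n) → (a xor b) · v ≡ a · v ⊕ b · v
·-xor false b     v = sym (⊕-identityˡ _)
·-xor true  false v = sym (⊕-identityʳ v)
·-xor true  true  v = sym (⊕-self v)

·-⊕ : ∀ {n} a (u v : Vec Bool n) → a · (u ⊕ v) ≡ a · u ⊕ a · v
·-⊕ false u v = sym (⊕-identityˡ 𝟘)
·-⊕ true  u v = refl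

·-𝟘 : ∀ {n} a → a · 𝟘 {n} ≡ 𝟘
·-𝟘 false = refl
·-𝟘 true  = refl

initV : ∀ {n} → Vec Bool (suc n) → Vec Bool n
initV {zero}  (x ∷ [])  = []
initV {suc n} (x ∷ xs)  = x ∷ initV xs

lastV : ∀ {n} → Vec Bool (suc n) → Bool
lastV {zero}  (x ∷ [])  = x
lastV {suc n} (x ∷ xs)  = lastV xs

initV-⊕ : ∀ {n} (u v : Vec Bool (suc n)) → initV (u ⊕ v) ≡ initV u ⊕ initV v
initV-⊕ {zero}  (a ∷ []) (b ∷ []) = refl
initV-⊕ {suc n} (a ∷ u)  (b ∷ v)  = cong ((a xor b) ∷_) (initV-⊕ u v)

lastV-⊕ : ∀ {n} (u v : Vec Bool (suc n)) → lastV (u ⊕ v) ≡ lastV u xor lastV v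
lastV-⊕ {zero}  (a ∷ []) (b ∷ []) = refl
lastV-⊕ {suc n} (a ∷ u)  (b ∷ v)  = lastV-⊕ u v

initV-𝟘 : ∀ {n} → initV {n} 𝟘 ≡ 𝟘
initV-𝟘 {zero}  = refl
initV-𝟘 {suc n} = cong (false ∷_) initV-𝟘

lastV-𝟘 : ∀ {n} → lastV {n} 𝟘 ≡ false
lastV-𝟘 {zero}  = refl
lastV-𝟘 {suc n} = lastV-𝟘 {n}

coefV : ∀ {n} → Vec Bool n → ℕ → Bool
coefV v = coef (toList v)

coefV-⊕ : ∀ {n} (u v : Vec Bool n) i → coefV (u ⊕ v) i ≡ coefV u i xor coefV v i
coefV-⊕ []      []      i       = refl
coefV-⊕ (a ∷ u) (b ∷ v) zero    = refl
coefV-⊕ (a ∷ u) (b ∷ v) (suc i) = coefV-⊕ u v i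

coefV-𝟘 : ∀ {n} i → coefV (𝟘 {n}) i ≡ false
coefV-𝟘 {zero}  i       = refl
coefV-𝟘 {suc n} zero    = refl
coefV-𝟘 {suc n} (suc i) = coefV-𝟘 {n} i

coefV-· : ∀ {n} b (v : Vec Bool n) i → coefV (b · v) i ≡ b ∧ coefV v i
coefV-· {n} false v i = coefV-𝟘 {n} i
coefV-· true  v i = refl

coefV-initV-lastV : ∀ {n} (r : Vec Bool (suc n)) i → coefV r i ≡ coefV (initV r) i xor (lastV r ∧ (i ≡ᵇ n))
coefV-initV-lastV {zero}  (a ∷ []) zero    = sym (∧-identityʳ a)
coefV-initV-lastV {zero}  (a ∷ []) (suc i) = sym (∧-zeroʳ a)
coefV-initV-lastV {suc n} (a ∷ r)  zero    = sym (trans (cong (a xor_) (∧-zeroʳ (lastV r))) (xor-identityʳ a))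
coefV-initV-lastV {suc n} (a ∷ r)  (suc i) = coefV-initV-lastV r i

pad : ∀ {m} → Poly → Vec Bool m
pad {zero}  _        = []
pad {suc m} []       = false ∷ pad []
pad {suc m} (c ∷ cs) = c ∷ pad cs

pad-[] : ∀ {m} → pad {m} [] ≡ 𝟘
pad-[] {zero}  = refl
pad-[] {suc m} = cong (false ∷_) pad-[]

initV-pad : ∀ {m} cs → initV {m} (pad cs) ≡ pad cs
initV-pad {zero}  []       = refl
initV-pad {zero}  (c ∷ cs) = refl
initV-pad {suc m} []       = cong (false ∷_) (initV-pad [])
initV-pad {suc m} (c ∷ cs) = cong (c ∷_) (initV-pad cs)

lastV-pad : ∀ {m} cs → length cs ≤ m → lastV {m} (pad cs) ≡ false
lastV-pad {zero}  []       _       = refl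
lastV-pad {suc m} []       _       = lastV-pad {m} [] z≤n
lastV-pad {suc m} (c ∷ cs) (s≤s l) = lastV-pad cs l

pad-toList : ∀ {m} (v : Vec Bool m) → pad (toList v) ≡ v
pad-toList []      = refl
pad-toList (a ∷ v) = cong (a ∷_) (pad-toList v)

-- Residues modulo the monic polynomial low + X^(d+1), as coefficient vectors (lowest degree first).
module Residue {d : ℕ} (low : Vec Bool (suc d)) where

  R : Set
  R = Vec Bool (suc d)

  modulus : Poly
  modulus = toList low ++ [ true ]

  X· : R → R
  X· u = (false ∷ initV u) ⊕ lastV u · low

  1ᵣ : R
  1ᵣ = true ∷ 𝟘

  eval : Poly → R → R
  eval []      x = 𝟘
  eval (c ∷ p) x = c · x ⊕ X· (eval p x)

  reduce : Poly → R
  reduce p = eval p 1ᵣ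

  infixl 30 _*ᵣ_
  _*ᵣ_ : R → R → R
  a *ᵣ b = eval (toList a) b

  X·-⊕ : ∀ u v → X· (u ⊕ v) ≡ X· u ⊕ X· v
  X·-⊕ u v = begin
    (false ∷ initV (u ⊕ v)) ⊕ lastV (u ⊕ v) · low
      ≡⟨ cong₂ (λ i t → (false ∷ i) ⊕ t · low) (initV-⊕ u v) (lastV-⊕ u v) ⟩
    (false ∷ (initV u ⊕ initV v)) ⊕ (lastV u xor lastV v) · low
      ≡⟨ cong ((false ∷ (initV u ⊕ initV v)) ⊕_) (·-xor (lastV u) (lastV v) low) ⟩
    ((false ∷ initV u) ⊕ (false ∷ initV v)) ⊕ (lastV u · low ⊕ lastV v · low)
      ≡⟨ ⊕-interchange (false ∷ initV u) (false ∷ initV v) (lastV u · low) (lastV v · low) ⟩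
    X· u ⊕ X· v
      ∎

  X·-𝟘 : X· 𝟘 ≡ 𝟘
  X·-𝟘 = trans (cong₂ (λ i t → (false ∷ i) ⊕ t · low) initV-𝟘 (lastV-𝟘 {d})) (⊕-identityʳ (false ∷ 𝟘))

  X·-· : ∀ b x → X· (b · x) ≡ b · X· x
  X·-· false x = X·-𝟘
  X·-· true  x = refl

  eval-⊕ : ∀ p x y → eval p (x ⊕ y) ≡ eval p x ⊕ eval p y
  eval-⊕ []      x y = sym (⊕-identityˡ 𝟘)
  eval-⊕ (c ∷ p) x y = begin
    c · (x ⊕ y) ⊕ X· (eval p (x ⊕ y))
      ≡⟨ cong₂ _⊕_ (·-⊕ c x y) (trans (cong X· (eval-⊕ p x y)) (X·-⊕ (eval p x) (eval p y))) ⟩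
    (c · x ⊕ c · y) ⊕ (X· (eval p x) ⊕ X· (eval p y))
      ≡⟨ ⊕-interchange (c · x) (c · y) (X· (eval p x)) (X· (eval p y)) ⟩
    eval (c ∷ p) x ⊕ eval (c ∷ p) y
      ∎

  eval-𝟘 : ∀ p → eval p 𝟘 ≡ 𝟘
  eval-𝟘 []      = refl
  eval-𝟘 (c ∷ p) = trans (cong₂ _⊕_ (·-𝟘 c) (trans (cong X· (eval-𝟘 p)) X·-𝟘)) (⊕-identityˡ 𝟘)

  eval-· : ∀ p b x → eval p (b · x) ≡ b · eval p x
  eval-· p false x = eval-𝟘 p
  eval-· p true  x = refl

  eval-X· : ∀ p x → eval p (X· x) ≡ X· (eval p x)
  eval-X· []      x = sym X·-𝟘
  eval-X· (c ∷ p) x = begin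
    c · X· x ⊕ X· (eval p (X· x))      ≡⟨ cong₂ _⊕_ (sym (X·-· c x)) (cong X· (eval-X· p x)) ⟩
    X· (c · x) ⊕ X· (X· (eval p x))    ≡⟨ X·-⊕ (c · x) (X· (eval p x)) ⟨
    X· (eval (c ∷ p) x)                ∎

  eval-comm : ∀ p q x → eval p (eval q x) ≡ eval q (eval p x)
  eval-comm p []      x = eval-𝟘 p
  eval-comm p (c ∷ q) x = begin
    eval p (c · x ⊕ X· (eval q x))             ≡⟨ eval-⊕ p (c · x) (X· (eval q x)) ⟩
    eval p (c · x) ⊕ eval p (X· (eval q x))    ≡⟨ cong₂ _⊕_ (eval-· p c x) (eval-X· p (eval q x)) ⟩
    c · eval p x ⊕ X· (eval p (eval q x))      ≡⟨ cong (λ y → c · eval p x ⊕ X· y) (eval-comm p q x) ⟩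
    eval (c ∷ q) (eval p x)                    ∎

  eval-+ₚ : ∀ p q x → eval (p +ₚ q) x ≡ eval p x ⊕ eval q x
  eval-+ₚ []      q       x = sym (⊕-identityˡ _)
  eval-+ₚ (a ∷ p) []      x = sym (⊕-identityʳ _)
  eval-+ₚ (a ∷ p) (b ∷ q) x = begin
    (a xor b) · x ⊕ X· (eval (p +ₚ q) x)
      ≡⟨ cong₂ _⊕_ (·-xor a b x) (trans (cong X· (eval-+ₚ p q x)) (X·-⊕ (eval p x) (eval q x))) ⟩
    (a · x ⊕ b · x) ⊕ (X· (eval p x) ⊕ X· (eval q x))
      ≡⟨ ⊕-interchange (a · x) (b · x) (X· (eval p x)) (X· (eval q x)) ⟩
    eval (a ∷ p) x ⊕ eval (b ∷ q) x
      ∎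

  eval-*ₚ : ∀ p q x → eval (p *ₚ q) x ≡ eval p (eval q x)
  eval-*ₚ []      q x = refl
  eval-*ₚ (b ∷ p) q x = begin
    eval ((if b then q else []) +ₚ (false ∷ (p *ₚ q))) x
      ≡⟨ eval-+ₚ (if b then q else []) (false ∷ (p *ₚ q)) x ⟩
    eval (if b then q else []) x ⊕ (𝟘 ⊕ X· (eval (p *ₚ q) x))
      ≡⟨ cong₂ _⊕_ (scaled b) (trans (⊕-identityˡ _) (cong X· (eval-*ₚ p q x))) ⟩
    eval (b ∷ p) (eval q x)
      ∎
    where
    scaled : ∀ b → eval (if b then q else []) x ≡ b · eval q x
    scaled true  = refl
    scaled false = refl

  eval-coef : ∀ p q → coef p ≗ coef q → ∀ x → eval p x ≡ eval q x
  eval-coef []      []       e x = refl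
  eval-coef []      (b ∷ q)  e x = sym (trans (cong₂ (λ c y → c · x ⊕ X· y) (sym (e zero)) (sym (eval-coef [] q (λ i → e (suc i)) x)))
                                              (trans (⊕-identityˡ _) X·-𝟘))
  eval-coef (b ∷ p) []       e x = trans (cong₂ (λ c y → c · x ⊕ X· y) (e zero) (eval-coef p [] (λ i → e (suc i)) x))
                                         (trans (⊕-identityˡ _) X·-𝟘)
  eval-coef (b ∷ p) (b′ ∷ q) e x = cong₂ (λ c y → c · x ⊕ X· y) (e zero) (eval-coef p q (λ i → e (suc i)) x)

  eval-pad : ∀ cs → length cs ≤ suc d → reduce cs ≡ pad cs
  eval-pad []       _       = sym pad-[]
  eval-pad (c ∷ cs) (s≤s l) = begin
    c · 1ᵣ ⊕ X· (reduce cs)      ≡⟨ cong (λ y → c · 1ᵣ ⊕ X· y) (eval-pad cs (≤-trans l (n≤1+n d))) ⟩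
    c · 1ᵣ ⊕ X· (pad cs)         ≡⟨ cong (c · 1ᵣ ⊕_) no-overflow ⟩
    c · 1ᵣ ⊕ (false ∷ pad cs)    ≡⟨ leading c ⟩
    pad (c ∷ cs)                 ∎
    where
    no-overflow : X· (pad cs) ≡ false ∷ pad cs
    no-overflow = trans (cong₂ (λ i t → (false ∷ i) ⊕ t · low) (initV-pad cs) (lastV-pad cs l)) (⊕-identityʳ _)
    leading : ∀ c → c · 1ᵣ ⊕ (false ∷ pad cs) ≡ pad (c ∷ cs)
    leading true  = cong (true ∷_) (⊕-identityˡ _)
    leading false = cong (false ∷_) (⊕-identityˡ _)

  reduce-toList : ∀ v → reduce (toList v) ≡ v
  reduce-toList v = trans (eval-pad (toList v) (subst (_≤ suc d) (sym (length-toList v)) ≤-refl)) (pad-toList v)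

  reduce-1 : reduce [ true ] ≡ 1ᵣ
  reduce-1 = trans (cong (1ᵣ ⊕_) X·-𝟘) (⊕-identityʳ 1ᵣ)

  eval-reduce : ∀ p q → reduce p ≡ reduce q → ∀ y → eval p y ≡ eval q y
  eval-reduce p q e y = begin
    eval p y                          ≡⟨ cong (eval p) (reduce-toList y) ⟨
    eval p (eval (toList y) 1ᵣ)       ≡⟨ eval-comm p (toList y) 1ᵣ ⟩
    eval (toList y) (reduce p)        ≡⟨ cong (eval (toList y)) e ⟩
    eval (toList y) (reduce q)        ≡⟨ eval-comm q (toList y) 1ᵣ ⟨
    eval q (eval (toList y) 1ᵣ)       ≡⟨ cong (eval q) (reduce-toList y) ⟩
    eval q y                          ∎

  *ᵣ-comm : ∀ a b → a *ᵣ b ≡ b *ᵣ a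
  *ᵣ-comm a b = begin
    eval (toList a) b                 ≡⟨ cong (eval (toList a)) (reduce-toList b) ⟨
    eval (toList a) (reduce (toList b)) ≡⟨ eval-comm (toList a) (toList b) 1ᵣ ⟩
    eval (toList b) (reduce (toList a)) ≡⟨ cong (eval (toList b)) (reduce-toList a) ⟩
    eval (toList b) a                 ∎

  *ᵣ-reduce : ∀ p x → reduce p *ᵣ x ≡ eval p x
  *ᵣ-reduce p x = eval-reduce (toList (reduce p)) p (reduce-toList (reduce p)) x

  *ᵣ-assoc : ∀ a b c → (a *ᵣ b) *ᵣ c ≡ a *ᵣ (b *ᵣ c)
  *ᵣ-assoc a b c = begin
    (a *ᵣ b) *ᵣ c                                   ≡⟨ cong (λ y → eval (toList a) y *ᵣ c) (reduce-toList b) ⟨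
    eval (toList a) (reduce (toList b)) *ᵣ c        ≡⟨ cong (_*ᵣ c) (eval-*ₚ (toList a) (toList b) 1ᵣ) ⟨
    reduce (toList a *ₚ toList b) *ᵣ c              ≡⟨ *ᵣ-reduce (toList a *ₚ toList b) c ⟩
    eval (toList a *ₚ toList b) c                   ≡⟨ eval-*ₚ (toList a) (toList b) c ⟩
    a *ᵣ (b *ᵣ c)                                   ∎

  *ᵣ-identityʳ : ∀ a → a *ᵣ 1ᵣ ≡ a
  *ᵣ-identityʳ = reduce-toList

  *ᵣ-identityˡ : ∀ b → 1ᵣ *ᵣ b ≡ b
  *ᵣ-identityˡ b = trans (*ᵣ-comm 1ᵣ b) (*ᵣ-identityʳ b)

  *ᵣ-distribʳ-⊕ : ∀ a b c → (a ⊕ b) *ᵣ c ≡ a *ᵣ c ⊕ b *ᵣ c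
  *ᵣ-distribʳ-⊕ a b c = begin
    (a ⊕ b) *ᵣ c                                        ≡⟨ cong₂ (λ x y → (x ⊕ y) *ᵣ c) (reduce-toList a) (reduce-toList b) ⟨
    (reduce (toList a) ⊕ reduce (toList b)) *ᵣ c        ≡⟨ cong (_*ᵣ c) (eval-+ₚ (toList a) (toList b) 1ᵣ) ⟨
    reduce (toList a +ₚ toList b) *ᵣ c                  ≡⟨ *ᵣ-reduce (toList a +ₚ toList b) c ⟩
    eval (toList a +ₚ toList b) c                       ≡⟨ eval-+ₚ (toList a) (toList b) c ⟩
    a *ᵣ c ⊕ b *ᵣ c                                     ∎

  X·ⁿ : ℕ → R → R
  X·ⁿ zero    x = x
  X·ⁿ (suc m) x = X· (X·ⁿ m x)

  eval-++ : ∀ l l′ x → eval (l ++ l′) x ≡ eval l x ⊕ X·ⁿ (length l) (eval l′ x)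
  eval-++ []      l′ x = sym (⊕-identityˡ _)
  eval-++ (c ∷ l) l′ x = begin
    c · x ⊕ X· (eval (l ++ l′) x)                             ≡⟨ cong (λ y → c · x ⊕ X· y) (eval-++ l l′ x) ⟩
    c · x ⊕ X· (eval l x ⊕ X·ⁿ (length l) (eval l′ x))        ≡⟨ cong (c · x ⊕_) (X·-⊕ (eval l x) _) ⟩
    c · x ⊕ (X· (eval l x) ⊕ X·ⁿ (suc (length l)) (eval l′ x)) ≡⟨ ⊕-assoc (c · x) _ _ ⟨
    eval (c ∷ l) x ⊕ X·ⁿ (length (c ∷ l)) (eval l′ x)         ∎

  reduce-Xⁿ : ∀ n → reduce (replicate n false ++ [ true ]) ≡ X·ⁿ n 1ᵣ
  reduce-Xⁿ n = begin
    reduce (replicate n false ++ [ true ])                                   ≡⟨ eval-++ (replicate n false) [ true ] 1ᵣ ⟩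
    eval (replicate n false) 1ᵣ ⊕ X·ⁿ (length (replicate n false)) (reduce [ true ])
      ≡⟨ cong₂ _⊕_ (eval-zeros n) (cong₂ X·ⁿ (length-zeros n) reduce-1) ⟩
    𝟘 ⊕ X·ⁿ n 1ᵣ                                                             ≡⟨ ⊕-identityˡ _ ⟩
    X·ⁿ n 1ᵣ                                                                 ∎
    where
    length-zeros : ∀ m → length (replicate m false) ≡ m
    length-zeros zero    = refl
    length-zeros (suc m) = cong suc (length-zeros m)
    eval-zeros : ∀ m → eval (replicate m false) 1ᵣ ≡ 𝟘
    eval-zeros zero    = refl
    eval-zeros (suc m) = trans (cong (λ y → 𝟘 ⊕ X· y) (eval-zeros m)) (trans (⊕-identityˡ _) X·-𝟘)

  X·ⁿ-1ᵣ : X·ⁿ (suc d) 1ᵣ ≡ low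
  X·ⁿ-1ᵣ = begin
    X· (X·ⁿ d 1ᵣ)                  ≡⟨ cong X· (trans (sym (reduce-Xⁿ d)) (eval-pad unit (subst (_≤ suc d) (sym (length-unit d)) ≤-refl))) ⟩
    X· (pad unit)                  ≡⟨ cong₂ (λ i t → (false ∷ i) ⊕ t · low) (initV-unit d) (lastV-unit d) ⟩
    (false ∷ 𝟘) ⊕ low              ≡⟨ ⊕-identityˡ low ⟩
    low                            ∎
    where
    unit : Poly
    unit = replicate d false ++ [ true ]
    initV-unit : ∀ m → initV {m} (pad (replicate m false ++ [ true ])) ≡ 𝟘
    initV-unit zero    = refl
    initV-unit (suc m) = cong (false ∷_) (initV-unit m)
    lastV-unit : ∀ m → lastV {m} (pad (replicate m false ++ [ true ])) ≡ true
    lastV-unit zero    = refl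
    lastV-unit (suc m) = lastV-unit m
    length-unit : ∀ m → length (replicate m false ++ [ true ]) ≡ suc m
    length-unit zero    = refl
    length-unit (suc m) = cong suc (length-unit m)

  reduce-modulus : reduce modulus ≡ 𝟘
  reduce-modulus = begin
    reduce (toList low ++ [ true ])                                       ≡⟨ eval-++ (toList low) [ true ] 1ᵣ ⟩
    reduce (toList low) ⊕ X·ⁿ (length (toList low)) (reduce [ true ])     ≡⟨ cong₂ _⊕_ (reduce-toList low) (cong₂ X·ⁿ (length-toList low) reduce-1) ⟩
    low ⊕ X·ⁿ (suc d) 1ᵣ                                                  ≡⟨ cong (low ⊕_) X·ⁿ-1ᵣ ⟩
    low ⊕ low                                                             ≡⟨ ⊕-self low ⟩
    𝟘                                                                     ∎

  eval-modulus : ∀ y → eval modulus y ≡ 𝟘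
  eval-modulus y = eval-reduce modulus [] reduce-modulus y

  -- Dividing c + X·p: X·(p mod g) overflows by (lastV (p mod g))·g, which joins the quotient.
  quotient : Poly → Poly
  quotient []      = []
  quotient (c ∷ p) = lastV (reduce p) ∷ quotient p

  private
    coef-modulus : ∀ i → coef modulus i ≡ coefV low i xor (i ≡ᵇ suc d)
    coef-modulus = go (toList low) (length-toList low)
      where
      go : ∀ (l : Poly) {m} → length l ≡ m → ∀ i → coef (l ++ [ true ]) i ≡ coef l i xor (i ≡ᵇ m)
      go []      refl zero    = refl
      go []      refl (suc i) = refl
      go (b ∷ l) refl zero    = sym (xor-identityʳ b)
      go (b ∷ l) refl (suc i) = go l refl i

    coefV-reduce-∷ : ∀ c p i → coefV (reduce (c ∷ p)) i ≡
      (c ∧ coefV 1ᵣ i) xor (coefV (false ∷ initV (reduce p)) i xor (lastV (reduce p) ∧ coefV low i))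
    coefV-reduce-∷ c p i = begin
      coefV (c · 1ᵣ ⊕ X· (reduce p)) i
        ≡⟨ coefV-⊕ (c · 1ᵣ) (X· (reduce p)) i ⟩
      coefV (c · 1ᵣ) i xor coefV ((false ∷ initV (reduce p)) ⊕ lastV (reduce p) · low) i
        ≡⟨ cong₂ _xor_ (coefV-· c 1ᵣ i) (coefV-⊕ (false ∷ initV (reduce p)) (lastV (reduce p) · low) i) ⟩
      (c ∧ coefV 1ᵣ i) xor (coefV (false ∷ initV (reduce p)) i xor coefV (lastV (reduce p) · low) i)
        ≡⟨ cong (λ z → (c ∧ coefV 1ᵣ i) xor (coefV (false ∷ initV (reduce p)) i xor z)) (coefV-· (lastV (reduce p)) low i) ⟩
      (c ∧ coefV 1ᵣ i) xor (coefV (false ∷ initV (reduce p)) i xor (lastV (reduce p) ∧ coefV low i))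
        ∎

    division-head : ∀ t a c → c ≡ ((t ∧ (a xor false)) xor false) xor ((c ∧ true) xor (false xor (t ∧ a)))
    division-head = solve 3 (λ t a c →
      c := ((t :* (a :+ con false)) :+ con false) :+ ((c :* con true) :+ (con false :+ (t :* a)))) refl

    division-tail : ∀ t a b q c i → q xor (i xor (t ∧ b)) ≡ ((t ∧ (a xor b)) xor q) xor ((c ∧ false) xor (i xor (t ∧ a)))
    division-tail = solve 6 (λ t a b q c i →
      q :+ (i :+ (t :* b)) := ((t :* (a :+ b)) :+ q) :+ ((c :* con false) :+ (i :+ (t :* a)))) refl

  division : ∀ p i → coef p i ≡ coef (quotient p *ₚ modulus) i xor coefV (reduce p) i
  division []      i       = sym (coefV-𝟘 {suc d} i)
  division (c ∷ p) zero    = trans (division-head t (coefV low 0) c) (sym (cong₂ _xor_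
    (trans (coef-*ₚ-∷ t (quotient p) modulus 0) (cong (λ z → (t ∧ z) xor false) (coef-modulus 0)))
    (coefV-reduce-∷ c p 0)))
    where
      t : Bool
      t = lastV (reduce p)
  division (c ∷ p) (suc j) = begin
    coef p j
      ≡⟨ division p j ⟩
    Q xor coefV (reduce p) j
      ≡⟨ cong (Q xor_) (coefV-initV-lastV (reduce p) j) ⟩
    Q xor (I xor (t ∧ (j ≡ᵇ d)))
      ≡⟨ division-tail t (coefV low (suc j)) (j ≡ᵇ d) Q c I ⟩
    ((t ∧ (coefV low (suc j) xor (j ≡ᵇ d))) xor Q) xor ((c ∧ false) xor (I xor (t ∧ coefV low (suc j))))
      ≡⟨ cong₂ _xor_ quotient-term remainder-term ⟨
    coef (quotient (c ∷ p) *ₚ modulus) (suc j) xor coefV (reduce (c ∷ p)) (suc j)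
      ∎
    where
    t Q I : Bool
    t = lastV (reduce p)
    Q = coef (quotient p *ₚ modulus) j
    I = coefV (initV (reduce p)) j
    quotient-term : coef (quotient (c ∷ p) *ₚ modulus) (suc j) ≡ (t ∧ (coefV low (suc j) xor (j ≡ᵇ d))) xor Q
    quotient-term = trans (coef-*ₚ-∷ t (quotient p) modulus (suc j)) (cong (λ z → (t ∧ z) xor Q) (coef-modulus (suc j)))
    remainder-term : coefV (reduce (c ∷ p)) (suc j) ≡ (c ∧ false) xor (I xor (t ∧ coefV low (suc j)))
    remainder-term = trans (coefV-reduce-∷ c p (suc j)) (cong (λ z → (c ∧ z) xor (I xor (t ∧ coefV low (suc j)))) (coefV-𝟘 {d} j))

  remainder : ∀ p → coefV (reduce p) ≗ coef (p +ₚ (quotient p *ₚ modulus))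
  remainder p i = begin
    coefV (reduce p) i                            ≡⟨ xor-cancelˡ (coef qg i) _ ⟨
    (coef qg i xor coefV (reduce p) i) xor coef qg i ≡⟨ cong (_xor coef qg i) (division p i) ⟨
    coef p i xor coef qg i                        ≡⟨ coef-+ₚ p qg i ⟨
    coef (p +ₚ qg) i                              ∎
    where
    qg : Poly
    qg = quotient p *ₚ modulus

  multiple : ∀ p → reduce p ≡ 𝟘 → coef p ≗ coef (quotient p *ₚ modulus)
  multiple p p≡𝟘 i = begin
    coef p i                                        ≡⟨ division p i ⟩
    coef (quotient p *ₚ modulus) i xor coefV (reduce p) i ≡⟨ cong (λ r → coef (quotient p *ₚ modulus) i xor coefV r i) p≡𝟘 ⟩
    coef (quotient p *ₚ modulus) i xor coefV (𝟘 {suc d}) i ≡⟨ cong (coef (quotient p *ₚ modulus) i xor_) (coefV-𝟘 {suc d} i) ⟩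
    coef (quotient p *ₚ modulus) i xor false        ≡⟨ xor-identityʳ _ ⟩
    coef (quotient p *ₚ modulus) i                  ∎

-- Irreducible moduli

nonzero⇒monic : ∀ {m} (v : Vec Bool m) → ¬ v ≡ 𝟘 → ∃₂ λ j (l : Vec Bool j) → j < m × coefV v ≗ coef (toList l ++ [ true ])
nonzero⇒monic []      v≢𝟘 = contradiction refl v≢𝟘
nonzero⇒monic {suc n} (a ∷ v) av≢𝟘 with ≡-dec Bool._≟_ v 𝟘
... | yes refl = 0 , [] , s≤s z≤n , constant a av≢𝟘
  where
  constant : ∀ a → ¬ a ∷ v ≡ 𝟘 → coefV (a ∷ v) ≗ coef [ true ]
  constant false nz i       = contradiction refl nz
  constant true  nz zero    = refl
  constant true  nz (suc i) = coefV-𝟘 {n} i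
... | no v≢𝟘 with nonzero⇒monic v v≢𝟘
...   | j , l , j<m , e = suc j , a ∷ l , s≤s j<m , λ { zero → refl ; (suc i) → e i }

module _ {d} (low : Vec Bool (suc d)) where
  open Residue low

  module _ (irreducible : ∀ a b → (a *ₚ b) ≈ₚ modulus → deg a ≡ 0 ⊎ deg b ≡ 0) where

    private
      modulus-top : coef modulus (suc d) ≡ true
      modulus-top = subst (λ k → coef modulus k ≡ true) (length-toList low) (coef-monic-top (toList low))

      no-proper-divisor : ∀ (l : Poly) → 0 < length l → length l ≤ d → ∀ q →
        coef modulus ≗ coef (q *ₚ (l ++ [ true ])) → ⊥
      no-proper-divisor l 0<l l≤d q g≗qh with irreducible q (l ++ [ true ]) (coef⇒≈ₚ (q *ₚ (l ++ [ true ])) modulus (λ i → sym (g≗qh i)))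
      ... | inj₂ deg-h≡0 = contradiction (subst (0 <_) (trans (sym (deg-monic l)) deg-h≡0) 0<l) λ ()
      ... | inj₁ deg-q≡0 = contradiction (trans (sym modulus-top) (trans (g≗qh (suc d)) (qh-top (deg≡0⇒norm q deg-q≡0)))) λ ()
        where
        qh-top : norm q ≡ [] ⊎ norm q ≡ [ true ] → coef (q *ₚ (l ++ [ true ])) (suc d) ≡ false
        qh-top (inj₁ q≈0) = coef-*ₚ-congˡ q [] (l ++ [ true ]) (≈ₚ⇒coef {q} {[]} q≈0) (suc d)
        qh-top (inj₂ q≈1) = begin
          coef (q *ₚ (l ++ [ true ])) (suc d)         ≡⟨ coef-*ₚ-congˡ q [ true ] (l ++ [ true ]) (≈ₚ⇒coef {q} {[ true ]} q≈1) (suc d) ⟩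
          coef ([ true ] *ₚ (l ++ [ true ])) (suc d)  ≡⟨ coef-1*ₚ (l ++ [ true ]) (suc d) ⟩
          coef (l ++ [ true ]) (suc d)                ≡⟨ coef-monic-beyond l (suc d) (s≤s l≤d) ⟩
          false                                       ∎

    module _ (γ : R) (γ≢𝟘 : ¬ γ ≡ 𝟘) where

      private
        eval-modulus+multiple : ∀ q h → eval h γ ≡ 𝟘 → eval (modulus +ₚ (q *ₚ h)) γ ≡ 𝟘
        eval-modulus+multiple q h kills = begin
          eval (modulus +ₚ (q *ₚ h)) γ         ≡⟨ eval-+ₚ modulus (q *ₚ h) γ ⟩
          eval modulus γ ⊕ eval (q *ₚ h) γ     ≡⟨ cong₂ _⊕_ (eval-modulus γ) (eval-*ₚ q h γ) ⟩
          𝟘 ⊕ eval q (eval h γ)                ≡⟨ cong (λ y → 𝟘 ⊕ eval q y) kills ⟩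
          𝟘 ⊕ eval q 𝟘                         ≡⟨ cong (𝟘 ⊕_) (eval-𝟘 q) ⟩
          𝟘 ⊕ 𝟘                                ≡⟨ ⊕-identityˡ 𝟘 ⟩
          𝟘                                    ∎

      -- Euclid's algorithm on the annihilator of γ: the remainder of the modulus by an
      -- annihilating monic polynomial of smaller degree annihilates γ as well.
      no-small-annihilator : ∀ fuel j (l : Vec Bool j) → j < fuel → j ≤ d → ¬ eval (toList l ++ [ true ]) γ ≡ 𝟘
      no-small-annihilator (suc fuel) zero    []  _          _   kills =
        γ≢𝟘 (trans (sym (trans (cong (γ ⊕_) X·-𝟘) (⊕-identityʳ γ))) kills)
      no-small-annihilator (suc fuel) (suc e) l (s≤s e<fuel) e<d kills with ≡-dec Bool._≟_ (Residue.reduce l modulus) 𝟘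
      ... | yes r≡𝟘 = no-proper-divisor (toList l) (subst (0 <_) (sym (length-toList l)) (s≤s z≤n))
                        (subst (_≤ d) (sym (length-toList l)) e<d) (Residue.quotient l modulus) (Residue.multiple l modulus r≡𝟘)
      ... | no r≢𝟘 with nonzero⇒monic (Residue.reduce l modulus) r≢𝟘
      ...   | j , l′ , j<e , l′≗r = no-small-annihilator fuel j l′ (≤-trans j<e e<fuel) (≤-trans (n≤1+n j) (≤-trans j<e e<d))
        (trans (eval-coef (toList l′ ++ [ true ]) (modulus +ₚ (Residue.quotient l modulus *ₚ Residue.modulus l))
                          (λ i → trans (sym (l′≗r i)) (Residue.remainder l modulus i)) γ)
               (eval-modulus+multiple (Residue.quotient l modulus) (Residue.modulus l) kills))

    *ᵣ-noZeroDivisors : ∀ ζ γ → ¬ ζ ≡ 𝟘 → ¬ γ ≡ 𝟘 → ¬ ζ *ᵣ γ ≡ 𝟘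
    *ᵣ-noZeroDivisors ζ γ ζ≢𝟘 γ≢𝟘 ζγ≡𝟘 with nonzero⇒monic ζ ζ≢𝟘
    ... | j , l , s≤s j≤d , ζ≗l =
      no-small-annihilator γ γ≢𝟘 (suc j) j l ≤-refl j≤d (trans (sym (eval-coef (toList ζ) (toList l ++ [ true ]) ζ≗l γ)) ζγ≡𝟘)

module _ {d} (rest : Vec Bool d) where
  open Residue (true ∷ rest)

  private
    initV-∷ʳ : ∀ {n} (v : Vec Bool n) b → initV (v ∷ʳ b) ≡ v
    initV-∷ʳ []      b = refl
    initV-∷ʳ (x ∷ v) b = cong (x ∷_) (initV-∷ʳ v b)

    lastV-∷ʳ : ∀ {n} (v : Vec Bool n) b → lastV (v ∷ʳ b) ≡ b
    lastV-∷ʳ []      b = refl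
    lastV-∷ʳ (x ∷ v) b = lastV-∷ʳ v b

    initV-∷ʳ-lastV : ∀ {n} (u : Vec Bool (suc n)) → initV u ∷ʳ lastV u ≡ u
    initV-∷ʳ-lastV {zero}  (x ∷ []) = refl
    initV-∷ʳ-lastV {suc n} (x ∷ u)  = cong (x ∷_) (initV-∷ʳ-lastV u)

    ⊕-cancelʳ : ∀ {n} (u v : Vec Bool n) → (u ⊕ v) ⊕ v ≡ u
    ⊕-cancelʳ u v = trans (⊕-assoc u v v) (trans (cong (u ⊕_) (⊕-self v)) (⊕-identityʳ u))

  X·-∷ : ∀ u → X· u ≡ lastV u ∷ (initV u ⊕ lastV u · rest)
  X·-∷ u = rotate (lastV u)
    where
    rotate : ∀ b → (false ∷ initV u) ⊕ b · (true ∷ rest) ≡ b ∷ (initV u ⊕ b · rest)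
    rotate true  = refl
    rotate false = refl

  X·⁻¹ : R → R
  X·⁻¹ (h ∷ t) = (t ⊕ h · rest) ∷ʳ h

  X·-X·⁻¹ : ∀ w → X· (X·⁻¹ w) ≡ w
  X·-X·⁻¹ (h ∷ t) = begin
    X· ((t ⊕ h · rest) ∷ʳ h)
      ≡⟨ X·-∷ _ ⟩
    lastV ((t ⊕ h · rest) ∷ʳ h) ∷ (initV ((t ⊕ h · rest) ∷ʳ h) ⊕ lastV ((t ⊕ h · rest) ∷ʳ h) · rest)
      ≡⟨ cong₂ (λ i b → b ∷ (i ⊕ b · rest)) (initV-∷ʳ (t ⊕ h · rest) h) (lastV-∷ʳ (t ⊕ h · rest) h) ⟩
    h ∷ ((t ⊕ h · rest) ⊕ h · rest)
      ≡⟨ cong (h ∷_) (⊕-cancelʳ t (h · rest)) ⟩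
    h ∷ t
      ∎

  X·⁻¹-X· : ∀ u → X·⁻¹ (X· u) ≡ u
  X·⁻¹-X· u = begin
    X·⁻¹ (X· u)                                          ≡⟨ cong X·⁻¹ (X·-∷ u) ⟩
    ((initV u ⊕ lastV u · rest) ⊕ lastV u · rest) ∷ʳ lastV u ≡⟨ cong (_∷ʳ lastV u) (⊕-cancelʳ (initV u) (lastV u · rest)) ⟩
    initV u ∷ʳ lastV u                                   ≡⟨ initV-∷ʳ-lastV u ⟩
    u                                                    ∎

  X·-injective : ∀ {u v} → X· u ≡ X· v → u ≡ v
  X·-injective {u} {v} e = trans (sym (X·⁻¹-X· u)) (trans (cong X·⁻¹ e) (X·⁻¹-X· v))

  X·-permutation : Permutation (2 ^ suc d) (2 ^ suc d)
  X·-permutation = permutation (encode ∘ X· ∘ decode) (encode ∘ X·⁻¹ ∘ decode)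
    (λ i → trans (cong (encode ∘ X·) (decode-encode (X·⁻¹ (decode i)))) (trans (cong encode (X·-X·⁻¹ _)) (encode-decode (suc d) i)))
    (λ i → trans (cong (encode ∘ X·⁻¹) (decode-encode (X· (decode i)))) (trans (cong encode (X·⁻¹-X· _)) (encode-decode (suc d) i)))

  X·≡X*ᵣ : ∀ x → X· 1ᵣ *ᵣ x ≡ X· x
  X·≡X*ᵣ x = begin
    X· 1ᵣ *ᵣ x                         ≡⟨ eval-reduce (toList (X· 1ᵣ)) (false ∷ [ true ]) X-reduced x ⟩
    𝟘 ⊕ X· (eval [ true ] x)           ≡⟨ ⊕-identityˡ _ ⟩
    X· (x ⊕ X· 𝟘)                      ≡⟨ cong (λ y → X· (x ⊕ y)) X·-𝟘 ⟩
    X· (x ⊕ 𝟘)                         ≡⟨ cong X· (⊕-identityʳ x) ⟩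
    X· x                               ∎
    where
    X-reduced : reduce (toList (X· 1ᵣ)) ≡ reduce (false ∷ [ true ])
    X-reduced = trans (reduce-toList (X· 1ᵣ)) (sym (trans (⊕-identityˡ _) (cong X· reduce-1)))

  module _ (irreducible : ∀ a b → (a *ₚ b) ≈ₚ modulus → deg a ≡ 0 ⊎ deg b ≡ 0) where

    private
      *ᵣ-commutativeMonoid : CommutativeMonoid _ _
      *ᵣ-commutativeMonoid = record
        { Carrier = R ; _≈_ = _≡_ ; _∙_ = _*ᵣ_ ; ε = 1ᵣ
        ; isCommutativeMonoid = record
          { isMonoid = record
            { isSemigroup = record
              { isMagma = record { isEquivalence = isEquivalence ; ∙-cong = cong₂ _*ᵣ_ }
              ; assoc = *ᵣ-assoc }
            ; identity = *ᵣ-identityˡ , *ᵣ-identityʳ }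
          ; comm = *ᵣ-comm } }

      open import Algebra.Properties.CommutativeMonoid.Sum *ᵣ-commutativeMonoid
        using (sum-permute; sum-cong-≗; ∑-distrib-+; sum-remove) renaming (sum to ∏)

      noZeroDivisors : ∀ ζ γ → ¬ ζ ≡ 𝟘 → ¬ γ ≡ 𝟘 → ¬ ζ *ᵣ γ ≡ 𝟘
      noZeroDivisors = *ᵣ-noZeroDivisors (true ∷ rest) irreducible

      -- replace 0 by 1, so that ∏ over all of R is the product of the nonzero residues
      nonzero : R → R
      nonzero β with ≡-dec Bool._≟_ β 𝟘
      ... | yes _ = 1ᵣ
      ... | no  _ = β

      ratio : R → R
      ratio β with ≡-dec Bool._≟_ β 𝟘
      ... | yes _ = 1ᵣ
      ... | no  _ = X· 1ᵣ

      nonzero-≢𝟘 : ∀ β → ¬ nonzero β ≡ 𝟘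
      nonzero-≢𝟘 β with ≡-dec Bool._≟_ β 𝟘
      ... | yes _  = λ ()
      ... | no  β≢𝟘 = β≢𝟘

      nonzero-X· : ∀ β → nonzero (X· β) ≡ ratio β *ᵣ nonzero β
      nonzero-X· β with ≡-dec Bool._≟_ β 𝟘 | ≡-dec Bool._≟_ (X· β) 𝟘
      ... | yes refl | yes _    = sym (*ᵣ-identityˡ 1ᵣ)
      ... | yes refl | no  X𝟘≢𝟘 = contradiction X·-𝟘 X𝟘≢𝟘
      ... | no  β≢𝟘  | yes Xβ≡𝟘 = contradiction (X·-injective (trans Xβ≡𝟘 (sym X·-𝟘))) β≢𝟘
      ... | no  _    | no  _    = sym (X·≡X*ᵣ β)

      ∏-≢𝟘 : ∀ {n} (t : Fin n → R) → (∀ i → ¬ t i ≡ 𝟘) → ¬ ∏ t ≡ 𝟘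
      ∏-≢𝟘 {zero}  t nz = λ ()
      ∏-≢𝟘 {suc n} t nz = noZeroDivisors (t zero) (∏ (t ∘ suc)) (nz zero) (∏-≢𝟘 (t ∘ suc) (nz ∘ suc))

      ∏-X· : ∀ {n} (t : Fin n → R) → (∀ j → t j ≡ X· 1ᵣ) → ∏ t ≡ X·ⁿ n 1ᵣ
      ∏-X· {zero}  t all = refl
      ∏-X· {suc n} t all = begin
        t zero *ᵣ ∏ (t ∘ suc)        ≡⟨ cong₂ _*ᵣ_ (all zero) (∏-X· (t ∘ suc) (all ∘ suc)) ⟩
        X· 1ᵣ *ᵣ X·ⁿ n 1ᵣ            ≡⟨ X·≡X*ᵣ (X·ⁿ n 1ᵣ) ⟩
        X·ⁿ (suc n) 1ᵣ               ∎

      ∏-ratio : ∀ {n} (t : Fin n → R) i → t i ≡ 1ᵣ → (∀ j → ¬ j ≡ i → t j ≡ X· 1ᵣ) → ∏ t ≡ X·ⁿ (n ∸ 1) 1ᵣ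
      ∏-ratio {suc n} t i tᵢ≡1 others = begin
        ∏ t                                ≡⟨ sum-remove {i = i} t ⟩
        t i *ᵣ ∏ (t ∘ punchIn i)           ≡⟨ cong₂ _*ᵣ_ tᵢ≡1 (∏-X· (t ∘ punchIn i) λ j → others (punchIn i j) (punchInᵢ≢i i j)) ⟩
        1ᵣ *ᵣ X·ⁿ n 1ᵣ                     ≡⟨ *ᵣ-identityˡ _ ⟩
        X·ⁿ n 1ᵣ                           ∎

      N : ℕ
      N = 2 ^ suc d

      P : R
      P = ∏ (nonzero ∘ decode)

      P≡XᴺP : P ≡ X·ⁿ (N ∸ 1) 1ᵣ *ᵣ P
      P≡XᴺP = begin
        ∏ (nonzero ∘ decode)                              ≡⟨ sum-permute (nonzero ∘ decode) X·-permutation ⟩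
        ∏ (nonzero ∘ decode ∘ encode ∘ X· ∘ decode)       ≡⟨ sum-cong-≗ (λ i → cong nonzero (decode-encode (X· (decode i)))) ⟩
        ∏ (nonzero ∘ X· ∘ decode)                         ≡⟨ sum-cong-≗ (nonzero-X· ∘ decode) ⟩
        ∏ (λ i → ratio (decode i) *ᵣ nonzero (decode i))  ≡⟨ ∑-distrib-+ (ratio ∘ decode) (nonzero ∘ decode) ⟩
        ∏ (ratio ∘ decode) *ᵣ P                           ≡⟨ cong (_*ᵣ P) (∏-ratio (ratio ∘ decode) (encode (𝟘 {suc d})) (ratio-𝟘 (decode-encode 𝟘)) ratio-others) ⟩
        X·ⁿ (N ∸ 1) 1ᵣ *ᵣ P                               ∎
        where
        ratio-𝟘 : ∀ {β} → β ≡ 𝟘 → ratio β ≡ 1ᵣ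
        ratio-𝟘 {β} β≡𝟘 with ≡-dec Bool._≟_ β 𝟘
        ... | yes _   = refl
        ... | no β≢𝟘 = contradiction β≡𝟘 β≢𝟘
        ratio-others : ∀ j → ¬ j ≡ encode (𝟘 {suc d}) → ratio (decode j) ≡ X· 1ᵣ
        ratio-others j j≢ with ≡-dec Bool._≟_ (decode {suc d} j) 𝟘
        ... | yes e = contradiction (trans (sym (encode-decode (suc d) j)) (cong encode e)) j≢
        ... | no  _ = refl

    fermat : X·ⁿ (2 ^ suc d ∸ 1) 1ᵣ ≡ 1ᵣ
    fermat with ≡-dec Bool._≟_ (X·ⁿ (N ∸ 1) 1ᵣ ⊕ 1ᵣ) 𝟘
    ... | yes e  = ⊕≡𝟘⇒≡ e
    ... | no  ne = contradiction (begin
      (X·ⁿ (N ∸ 1) 1ᵣ ⊕ 1ᵣ) *ᵣ P            ≡⟨ *ᵣ-distribʳ-⊕ (X·ⁿ (N ∸ 1) 1ᵣ) 1ᵣ P ⟩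
      X·ⁿ (N ∸ 1) 1ᵣ *ᵣ P ⊕ 1ᵣ *ᵣ P         ≡⟨ cong₂ _⊕_ (sym P≡XᴺP) (*ᵣ-identityˡ P) ⟩
      P ⊕ P                                ≡⟨ ⊕-self P ⟩
      𝟘                                    ∎)
      (noZeroDivisors _ P ne (∏-≢𝟘 (nonzero ∘ decode) (nonzero-≢𝟘 ∘ decode)))

-- Periods of annihilated sequences

module _ {d} (rest : Vec Bool d) where
  open Residue (true ∷ rest)

  -- By fermat, g divides Xᴺ + 1, so σᴺ + 1 = (Xᴺ + 1)(σ) factors through g(σ).
  annihilator-period : (∀ a b → (a *ₚ b) ≈ₚ modulus → deg a ≡ 0 ⊎ deg b ≡ 0) →
    ∀ {v} → actσ modulus v ≗ 0ₛ → Periodic (2 ^ suc d ∸ 1) v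
  annihilator-period irreducible {v} kills i = xor≡false⇒≡ (begin
    v (N + i) xor v i                  ≡⟨ cong₂ _xor_ (actσ-Xⁿ N v i) (actσ-1 v i) ⟨
    actσ Xᴺ v i xor actσ [ true ] v i  ≡⟨ actσ-+ Xᴺ [ true ] v i ⟨
    actσ Xᴺ+1 v i                      ≡⟨ actσ-≈ {Xᴺ+1} {q *ₚ modulus} Xᴺ+1≈qg v i ⟩
    actσ (q *ₚ modulus) v i            ≡⟨ actσ-*ₚ q modulus v i ⟩
    actσ q (actσ modulus v) i          ≡⟨ actσ-cong q kills i ⟩
    actσ q 0ₛ i                        ≡⟨ actσ-0 q i ⟩
    false                              ∎)
    where
    N : ℕ
    N = 2 ^ suc d ∸ 1
    Xᴺ Xᴺ+1 q : Poly
    Xᴺ = replicate N false ++ [ true ]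
    Xᴺ+1 = Xᴺ +ₚ [ true ]
    q = quotient Xᴺ+1
    reduces : reduce Xᴺ+1 ≡ 𝟘
    reduces = begin
      reduce Xᴺ+1                      ≡⟨ eval-+ₚ Xᴺ [ true ] 1ᵣ ⟩
      reduce Xᴺ ⊕ reduce [ true ]      ≡⟨ cong₂ _⊕_ (trans (reduce-Xⁿ N) (fermat rest irreducible)) reduce-1 ⟩
      1ᵣ ⊕ 1ᵣ                          ≡⟨ ⊕-self 1ᵣ ⟩
      𝟘                                ∎
    Xᴺ+1≈qg : Xᴺ+1 ≈ₚ (q *ₚ modulus)
    Xᴺ+1≈qg = coef⇒≈ₚ Xᴺ+1 (q *ₚ modulus) (multiple Xᴺ+1 reduces)

X-annihilated : ∀ {k v} → Periodic (suc k) v → actσ (false ∷ [ true ]) v ≗ 0ₛ → v ≗ 0ₛ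
X-annihilated {k} {v} pv kills = v≗0
  where
  shifted≗0 : ∀ i → v (suc i) ≡ false
  shifted≗0 i = trans (sym (xor-identityʳ (v (suc i)))) (kills i)
  v≗0 : v ≗ 0ₛ
  v≗0 zero    = trans (sym (pv 0)) (shifted≗0 (k + 0))
  v≗0 (suc i) = shifted≗0 i

irreducible-annihilator-period : ∀ g → Irreducible g → ∀ {k v} → Periodic (suc k) v → actσ g v ≗ 0ₛ →
  Periodic (2 ^ deg g ∸ 1) v
irreducible-annihilator-period g (deg≥1 , irreducible) {k} {v} pv kills with norm≡[]⊎monic g
... | inj₁ g≈0 = contradiction (subst (1 ≤_) (cong (λ p → length p ∸ 1) g≈0) deg≥1) λ ()
... | inj₂ ([] , g≈1) = contradiction (subst (1 ≤_) (cong (λ p → length p ∸ 1) g≈1) deg≥1) λ ()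
... | inj₂ (true ∷ gr , g≈monic) = subst (λ n → Periodic (2 ^ n ∸ 1) v) (sym deg-g)
    (annihilator-period (fromList gr) irreducible′ (λ i → trans (actσ-≈ {modulus} {g} modulus≈g v i) (kills i)))
  where
  open Residue (true ∷ fromList gr)
  modulus≡ : modulus ≡ (true ∷ gr) ++ [ true ]
  modulus≡ = cong (λ l → true ∷ l ++ [ true ]) (toList∘fromList gr)
  modulus≈g : modulus ≈ₚ g
  modulus≈g = trans (cong norm modulus≡) (trans (norm-monic (true ∷ gr)) (sym g≈monic))
  irreducible′ : ∀ a b → (a *ₚ b) ≈ₚ modulus → deg a ≡ 0 ⊎ deg b ≡ 0
  irreducible′ a b ab≈m = irreducible a b (trans ab≈m modulus≈g)
  deg-g : deg g ≡ suc (length gr)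
  deg-g = trans (cong (λ p → length p ∸ 1) g≈monic) (length-monic (true ∷ gr))
... | inj₂ (false ∷ l , g≈Xq) with irreducible X q (coef⇒≈ₚ (X *ₚ q) g X*q≗g)
  where
  X : Poly
  X = false ∷ [ true ]
  q : Poly
  q = l ++ [ true ]
  X*q≗g : coef (X *ₚ q) ≗ coef g
  X*q≗g zero    = sym (trans (sym (coef-norm g zero)) (cong (λ p → coef p zero) g≈Xq))
  X*q≗g (suc i) = trans (coef-1*ₚ q i) (sym (trans (sym (coef-norm g (suc i))) (cong (λ p → coef p (suc i)) g≈Xq)))
...   | inj₁ ()
...   | inj₂ deg-q≡0 = λ i → trans (v≗0 (_ + i)) (sym (v≗0 i))
  where
  g≈X : g ≈ₚ (false ∷ [ true ])
  g≈X = trans g≈Xq (cong (λ l → false ∷ l ++ [ true ]) (length≡0⇒[] l (trans (sym (deg-monic l)) deg-q≡0)))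
    where
    length≡0⇒[] : ∀ (l : Poly) → length l ≡ 0 → l ≡ []
    length≡0⇒[] [] _ = refl
  v≗0 : v ≗ 0ₛ
  v≗0 = X-annihilated pv (λ i → trans (sym (actσ-≈ {g} {false ∷ [ true ]} g≈X v i)) (kills i))

private
  periodic-combine : ∀ {A B d v} a b → Periodic A v → Periodic B v → d + a * A ≡ b * B → Periodic d v
  periodic-combine {A} {B} {d} {v} a b pA pB eq i = begin
    v (d + i)                 ≡⟨ periodic-* a pA (d + i) ⟨
    v (a * A + (d + i))       ≡⟨ cong v (regroup d (a * A) i) ⟩
    v ((d + a * A) + i)       ≡⟨ cong (λ n → v (n + i)) eq ⟩
    v (b * B + i)             ≡⟨ periodic-* b pB i ⟩
    v i                       ∎
    where
    regroup : ∀ d m i → m + (d + i) ≡ (d + m) + i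
    regroup = solve-∀

periodic-gcd : ∀ {K N v} → Periodic K v → Periodic N v → Periodic (gcd K N) v
periodic-gcd {K} {N} pK pN with Bézout.identity (gcd-GCD K N)
... | Bézout.+- x y eq = periodic-combine y x pN pK eq
... | Bézout.-+ x y eq = periodic-combine x y pK pN eq

AnnihilatesMultiple : Poly → Seq → Set
AnnihilatesMultiple p w = ∃ λ c → (∃ λ i → actσ c w i ≡ true) × actσ p (actσ c w) ≗ 0ₛ

¬annihilatesMultiple-1 : ∀ {w} → ¬ AnnihilatesMultiple [ true ] w
¬annihilatesMultiple-1 {w} (c , (i , ui) , kills) =
  contradiction (trans (sym ui) (trans (sym (actσ-1 (actσ c w) i)) (kills i))) λ ()

module _ {k w} (pw : Periodic (suc k) w) where

  annihilatesMultiple-*ₚ : ∀ p q → AnnihilatesMultiple (p *ₚ q) w → AnnihilatesMultiple p w ⊎ AnnihilatesMultiple q w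
  annihilatesMultiple-*ₚ p q (c , nz , kills) with periodic-≗0⊎nonzero (actσ-periodic q (actσ-periodic c pw))
  ... | inj₁ q-kills       = inj₂ (c , nz , q-kills)
  ... | inj₂ (i , qcwᵢ)    = inj₁ (q *ₚ c , (i , trans (actσ-*ₚ q c w i) qcwᵢ) , λ j → begin
    actσ p (actσ (q *ₚ c) w) j       ≡⟨ actσ-cong p (actσ-*ₚ q c w) j ⟩
    actσ p (actσ q (actσ c w)) j     ≡⟨ actσ-*ₚ p q (actσ c w) j ⟨
    actσ (p *ₚ q) (actσ c w) j       ≡⟨ kills j ⟩
    false                            ∎)

  annihilatesMultiple-^ₚ : ∀ p e → AnnihilatesMultiple (p ^ₚ e) w → AnnihilatesMultiple p w
  annihilatesMultiple-^ₚ p zero    ann = contradiction ann ¬annihilatesMultiple-1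
  annihilatesMultiple-^ₚ p (suc e) ann with annihilatesMultiple-*ₚ p (p ^ₚ e) ann
  ... | inj₁ annₚ = annₚ
  ... | inj₂ annₑ = annihilatesMultiple-^ₚ p e annₑ

  annihilatesMultiple-prodPow : ∀ r g e → AnnihilatesMultiple (prodPow r g e) w → ∃ λ j → AnnihilatesMultiple (g j) w
  annihilatesMultiple-prodPow zero    g e ann = contradiction ann ¬annihilatesMultiple-1
  annihilatesMultiple-prodPow (suc r) g e ann
    with annihilatesMultiple-*ₚ (g zero ^ₚ e zero) (prodPow r (λ j → g (suc j)) (λ j → e (suc j))) ann
  ... | inj₁ ann₀ = zero , annihilatesMultiple-^ₚ (g zero) (e zero) ann₀
  ... | inj₂ annᵣ with annihilatesMultiple-prodPow r (λ j → g (suc j)) (λ j → e (suc j)) annᵣ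
  ...   | j , annⱼ = suc j , annⱼ

hasPeriodicKernel-gcd : ∀ {F r g e} → (∀ j → Irreducible (g j)) → F ≈ₚ prodPow r g e →
  ∀ {k} → HasPeriodicKernel F (suc k) → ∃ λ j → HasPeriodicKernel F (gcd (suc k) (2 ^ deg (g j) ∸ 1))
hasPeriodicKernel-gcd {F} {r} {g} {e} irreducible F≈∏ {k} (w , pw , (i , wᵢ) , F-kills-w)
  with annihilatesMultiple-prodPow pw r g e ([ true ] , (i , trans (actσ-1 w i) wᵢ) , ∏-kills-w)
  where
  ∏-kills-w : actσ (prodPow r g e) (actσ [ true ] w) ≗ 0ₛ
  ∏-kills-w j = trans (actσ-cong (prodPow r g e) (actσ-1 w) j)
                      (trans (actσ-≈ {prodPow r g e} {F} (sym F≈∏) w j) (F-kills-w j))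
... | j , c , nz , gⱼ-kills = j , actσ c w , periodic-gcd pcw 2ᵈ-1-periodic , nz , F-kills-cw
  where
  pcw : Periodic (suc k) (actσ c w)
  pcw = actσ-periodic c pw
  2ᵈ-1-periodic : Periodic (2 ^ deg (g j) ∸ 1) (actσ c w)
  2ᵈ-1-periodic = irreducible-annihilator-period (g j) (irreducible j) pcw gⱼ-kills
  F-kills-cw : actσ F (actσ c w) ≗ 0ₛ
  F-kills-cw j = trans (actσ-comm F c w j) (trans (actσ-cong c F-kills-w j) (actσ-0 c j))

corollary14 : (a : List Bool) (r : ℕ) (g : Fin r → Poly) (e : Fin r → ℕ) →
    (∀ j → Irreducible (g j)) → (∀ i j → g i ≈ₚ g j → i ≡ j) → (∀ j → e j ≥ 1) →
    polyF a ≈ₚ prodPow r g e →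
    Σ (ℕ → Set) λ ξ →
      (∀ m → ξ m → ∃ λ ℓ → ∃ λ j → m ≡ 2 * ℓ × ℓ ∣ (2 ^ deg (g j) ∸ 1)) ×
      (∀ n → n ≥ 1 → ((¬ IsPermutation (fMap a {n})) ⇔ (∃ λ m → ξ m × m ∣ n)))
corollary14 a r g e irreducible _ _ F≈∏ =
  ξ , (λ { m (ℓ , j , m≡2ℓ , ℓ∣ , _) → ℓ , j , m≡2ℓ , ℓ∣ }) , λ n n≥1 → mk⇔ (to n n≥1) (from n n≥1)
  where
  ξ : ℕ → Set
  ξ m = ∃₂ λ ℓ j → m ≡ 2 * ℓ × ℓ ∣ (2 ^ deg (g j) ∸ 1) × HasPeriodicKernel (polyF a) ℓ

  to : ∀ n → n ≥ 1 → ¬ IsPermutation (fMap a {n}) → ∃ λ m → ξ m × m ∣ n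
  to n n≥1 ¬perm with Equivalence.to (fMap-not-permutation⇔ a n n≥1) ¬perm
  ... | zero  , 0∣n  , _      = contradiction (subst (1 ≤_) (0∣⇒≡0 0∣n) n≥1) λ ()
  ... | suc k , 2K∣n , kernel with hasPeriodicKernel-gcd {polyF a} {r} {g} {e} irreducible F≈∏ kernel
  ...   | j , kernelℓ =
    2 * gcd (suc k) N , (gcd (suc k) N , j , refl , gcd[m,n]∣n (suc k) N , kernelℓ) ,
    ∣-trans (*-monoʳ-∣ 2 (gcd[m,n]∣m (suc k) N)) 2K∣n
    where
    N : ℕ
    N = 2 ^ deg (g j) ∸ 1

  from : ∀ n → n ≥ 1 → (∃ λ m → ξ m × m ∣ n) → ¬ IsPermutation (fMap a {n})
  from n n≥1 (m , (ℓ , j , refl , _ , kernel) , 2ℓ∣n) =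
    Equivalence.from (fMap-not-permutation⇔ a n n≥1) (ℓ , 2ℓ∣n , kernel)
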